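{- There is an absolute constant $C$ such that for every positive integer $r$ and every $m$ for which a $\overline{\mathrm{DD}}(m,r)$ exists, \[ m\leq \tfrac{1}{\sqrt{2}}\, r + \tfrac{3}{2^{4/3}}\,r^{2/3}+C\,r^{1/3}. \]
   Context: The square grid is $\mathbb{Z}^2$; the point $(i,j)$ lies in column $i$ and row $j$. The Manhattan distance is $d((i_1,j_1),(i_2,j_2))=|i_2-i_1|+|j_2-j_1|$. A $\overline{\mathrm{DD}}(m,r)$ (square distinct difference configuration) is a set of $m$ points ("dots") of $\mathbb{Z}^2$ such that (1) any two dots are at Manhattan distance at most $r$, and (2) the $\binom{m}{2}$ lines joining pairs of dots are pairwise distinct either in length or in slope; equivalently, the vectors $a-b$, over ordered pairs $(a,b)$ of distinct dots, are pairwise distinct. -}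

module Defs where

open import Data.Nat as ℕ using (ℕ)
open import Data.Integer as ℤ using (ℤ; ∣_∣; +_)
open import Data.Product using (_×_; _,_; proj₁; proj₂)
open import Data.Fin using (Fin)
open import Data.Rational using (ℚ; _/_)
open import Relation.Binary.PropositionalEquality using (_≡_; _≢_)

Point : Set
Point = ℤ × ℤ

dist : Point → Point → ℕ
dist (i₁ , j₁) (i₂ , j₂) = ∣ i₂ ℤ.- i₁ ∣ ℕ.+ ∣ j₂ ℤ.- j₁ ∣

diff : Point → Point → Point
diff (i₁ , j₁) (i₂ , j₂) = (i₁ ℤ.- i₂ , j₁ ℤ.- j₂)

-- A DD-bar(m, r): a set of m dots (an injective enumeration Fin m → ℤ²) with
-- (1) pairwise Manhattan distance ≤ r and
-- (2) the vectors a - b over ordered pairs of distinct dots pairwise distinct.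
record IsSquareDD (m r : ℕ) (dot : Fin m → Point) : Set where
  field
    distinct   : ∀ i j → dot i ≡ dot j → i ≡ j
    within     : ∀ i j → dist (dot i) (dot j) ℕ.≤ r
    distinctDiffs : ∀ i j k l → i ≢ j → k ≢ l →
                    diff (dot i) (dot j) ≡ diff (dot k) (dot l) → (i ≡ k) × (j ≡ l)

data SquareDDExists (m r : ℕ) : Set where
  witness : (dot : Fin m → Point) → IsSquareDD m r dot → SquareDDExists m r

ℕ→ℚ : ℕ → ℚ
ℕ→ℚ n = (+ n) / 1

module Submission where

-- In the rotated coordinates u = x + y, v = x − y the dots of a DD(m, r) lie in an r × r box. Slide a
-- 2h × 2h window over the (r + 2h)² positions meeting the box: each dot is in (2h)² windows, so the window
-- loads sum to m(2h)². A window with an ordered pair of distinct dots in it is determined by the dots' offsets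
-- (distinct differences), and by parity half of one v-offset suffices, so ∑ load² ≤ 8h⁴ + 4h²m. Cauchy–Schwarz
-- gives 4h²m² ≤ (r + 2h)²(2h² + m) for every h ≥ 1; taking h ≈ (r⁴/32)^(1/6) and solving for m yields
-- m ≤ r/√2 + 3r^(2/3)/2^(4/3) + O(r^(1/3)). All roots are replaced by integer approximations, and the
-- rational bounds q₁, q₂, q₃ by their integer parts.

module BigSum where

  open import Data.Nat
  open import Data.Nat.Properties
  open import Data.List using (List; []; _∷_; _++_; map; length; cartesianProduct)
  import Data.List.Properties as List
  open import Data.Product using (_×_; _,_)
  open import Data.Sum using ([_,_]′)
  open import Relation.Binary.PropositionalEquality
  open import Data.Nat.Tactic.RingSolver using (solve-∀)

  ∑ : ∀ {a} {A : Set a} → List A → (A → ℕ) → ℕ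
  ∑ []       f = 0
  ∑ (x ∷ xs) f = f x + ∑ xs f

  module _ {a} {A : Set a} where

    ∑-cong : ∀ (xs : List A) {f g : A → ℕ} → (∀ x → f x ≡ g x) → ∑ xs f ≡ ∑ xs g
    ∑-cong []       f≡g = refl
    ∑-cong (x ∷ xs) f≡g = cong₂ _+_ (f≡g x) (∑-cong xs f≡g)

    ∑-mono-≤ : ∀ (xs : List A) {f g : A → ℕ} → (∀ x → f x ≤ g x) → ∑ xs f ≤ ∑ xs g
    ∑-mono-≤ []       f≤g = z≤n
    ∑-mono-≤ (x ∷ xs) f≤g = +-mono-≤ (f≤g x) (∑-mono-≤ xs f≤g)

    ∑-distrib-+ : ∀ (xs : List A) (f g : A → ℕ) → ∑ xs (λ x → f x + g x) ≡ ∑ xs f + ∑ xs g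
    ∑-distrib-+ []       f g = refl
    ∑-distrib-+ (x ∷ xs) f g rewrite ∑-distrib-+ xs f g = interchange (f x) (g x) (∑ xs f) (∑ xs g)
      where interchange : ∀ a b c d → a + b + (c + d) ≡ a + c + (b + d)
            interchange = solve-∀

    *-distribˡ-∑ : ∀ (xs : List A) (c : ℕ) (f : A → ℕ) → c * ∑ xs f ≡ ∑ xs (λ x → c * f x)
    *-distribˡ-∑ []       c f = *-zeroʳ c
    *-distribˡ-∑ (x ∷ xs) c f rewrite sym (*-distribˡ-∑ xs c f) = *-distribˡ-+ c (f x) (∑ xs f)

    ∑-const : ∀ (xs : List A) (c : ℕ) → ∑ xs (λ _ → c) ≡ length xs * c
    ∑-const []       c = refl
    ∑-const (x ∷ xs) c = cong (c +_) (∑-const xs c)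

    ∑-++ : ∀ (xs ys : List A) (f : A → ℕ) → ∑ (xs ++ ys) f ≡ ∑ xs f + ∑ ys f
    ∑-++ []       ys f = refl
    ∑-++ (x ∷ xs) ys f rewrite ∑-++ xs ys f = sym (+-assoc (f x) _ _)

  ∑-map : ∀ {a b} {A : Set a} {B : Set b} (xs : List A) (g : A → B) (f : B → ℕ) →
          ∑ (map g xs) f ≡ ∑ xs (λ x → f (g x))
  ∑-map []       g f = refl
  ∑-map (x ∷ xs) g f = cong (f (g x) +_) (∑-map xs g f)

  module _ {a b} {A : Set a} {B : Set b} where

    ∑-comm : ∀ (xs : List A) (ys : List B) (f : A → B → ℕ) →
             ∑ xs (λ x → ∑ ys (f x)) ≡ ∑ ys (λ y → ∑ xs (λ x → f x y))
    ∑-comm []       ys f = sym (trans (∑-const {A = B} ys 0) (*-zeroʳ (length ys)))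
    ∑-comm (x ∷ xs) ys f rewrite ∑-comm xs ys f = sym (∑-distrib-+ ys (f x) _)

    ∑-cartesianProduct : ∀ (xs : List A) (ys : List B) (f : A × B → ℕ) →
                         ∑ (cartesianProduct xs ys) f ≡ ∑ xs (λ x → ∑ ys (λ y → f (x , y)))
    ∑-cartesianProduct []       ys f = refl
    ∑-cartesianProduct (x ∷ xs) ys f = trans (∑-++ (map (x ,_) ys) _ f)
      (cong₂ _+_ (∑-map ys (x ,_) f) (∑-cartesianProduct xs ys f))

    length-cartesianProduct : ∀ (xs : List A) (ys : List B) →
                              length (cartesianProduct xs ys) ≡ length xs * length ys
    length-cartesianProduct []       ys = refl
    length-cartesianProduct (x ∷ xs) ys = trans (List.length-++ (map (x ,_) ys))
      (cong₂ _+_ (List.length-map (x ,_) ys) (length-cartesianProduct xs ys))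

    ∑*∑ : ∀ (xs : List A) (ys : List B) (f : A → ℕ) (g : B → ℕ) →
          ∑ xs f * ∑ ys g ≡ ∑ xs (λ x → ∑ ys (λ y → f x * g y))
    ∑*∑ []       ys f g = refl
    ∑*∑ (x ∷ xs) ys f g = trans (*-distribʳ-+ (∑ ys g) (f x) (∑ xs f))
      (cong₂ _+_ (*-distribˡ-∑ ys (f x) g) (∑*∑ xs ys f g))

  2mn≤m²+n² : ∀ m n → 2 * (m * n) ≤ m * m + n * n
  2mn≤m²+n² m n = [ ordered , (λ n≤m → subst₂ _≤_ (cong (2 *_) (*-comm n m)) (+-comm (n * n) (m * m)) (ordered n≤m)) ]′
                   (≤-total m n)
    where
    ordered : ∀ {a b} → a ≤ b → 2 * (a * b) ≤ a * a + b * b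
    ordered {a} a≤b with m≤n⇒∃[o]m+o≡n a≤b
    ... | d , refl = subst (2 * (a * (a + d)) ≤_) (sym (expand a d)) (m≤m+n _ (d * d))
      where expand : ∀ a d → a * a + (a + d) * (a + d) ≡ 2 * (a * (a + d)) + d * d
            expand = solve-∀

  cauchy-schwarz : ∀ {a} {A : Set a} (xs : List A) (f : A → ℕ) →
                   ∑ xs f * ∑ xs f ≤ length xs * ∑ xs (λ x → f x * f x)
  cauchy-schwarz []       f = z≤n
  cauchy-schwarz (x ∷ xs) f = begin
      (f x + S) * (f x + S)                     ≡⟨ expand (f x) S ⟩
      S * S + 2 * (f x * S) + f x * f x          ≤⟨ +-monoˡ-≤ (f x * f x) (+-mono-≤ (cauchy-schwarz xs f) cross) ⟩
      n * Q + (Q + n * (f x * f x)) + f x * f x  ≡⟨ collect n Q (f x * f x) ⟩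
      (1 + n) * (f x * f x + Q)                  ∎
    where
    open ≤-Reasoning
    S = ∑ xs f
    Q = ∑ xs (λ y → f y * f y)
    n = length xs
    expand : ∀ a s → (a + s) * (a + s) ≡ s * s + 2 * (a * s) + a * a
    expand = solve-∀
    collect : ∀ n q b → n * q + (q + n * b) + b ≡ (1 + n) * (b + q)
    collect = solve-∀
    cross : 2 * (f x * S) ≤ Q + n * (f x * f x)
    cross = begin
      2 * (f x * S)                       ≡⟨ trans (cong (2 *_) (*-distribˡ-∑ xs (f x) f)) (*-distribˡ-∑ xs 2 _) ⟩
      ∑ xs (λ y → 2 * (f x * f y))        ≤⟨ ∑-mono-≤ xs (λ y → 2mn≤m²+n² (f x) (f y)) ⟩
      ∑ xs (λ y → f x * f x + f y * f y)  ≡⟨ ∑-distrib-+ xs _ _ ⟩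
      ∑ xs (λ _ → f x * f x) + Q          ≡⟨ trans (cong (_+ Q) (∑-const xs _)) (+-comm _ Q) ⟩
      Q + n * (f x * f x)                 ∎


module Counting where

  open import Data.Nat
  open import Data.Nat.Properties
  open import Data.List using (List; []; _∷_; _++_; length)
  import Data.List.Properties as List
  open import Data.List.Membership.Propositional using (_∈_)
  open import Data.List.Membership.Propositional.Properties using (∈-++⁻; ∈-++⁺ˡ; ∈-++⁺ʳ; ∈-∃++)
  open import Data.List.Relation.Unary.Any using (here; there)
  open import Data.List.Relation.Unary.All using (lookup)
  open import Data.List.Relation.Unary.AllPairs using (_∷_)
  open import Data.List.Relation.Unary.Unique.Propositional using (Unique)
  open import Data.Product using (_,_)
  open import Data.Sum using (inj₁; inj₂)
  open import Relation.Binary.PropositionalEquality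
  open import Relation.Nullary using (¬_)
  open import Data.Empty using (⊥-elim)
  open import Function using (_∘_)
  open BigSum

  module _ {a b} {A : Set a} {B : Set b} where

    ∈-remove : ∀ (ys₁ ys₂ : List B) {w z : B} → z ∈ ys₁ ++ w ∷ ys₂ → ¬ z ≡ w → z ∈ ys₁ ++ ys₂
    ∈-remove ys₁ ys₂ z∈ z≢w with ∈-++⁻ ys₁ z∈
    ... | inj₁ p         = ∈-++⁺ˡ p
    ... | inj₂ (here refl) = ⊥-elim (z≢w refl)
    ... | inj₂ (there p) = ∈-++⁺ʳ ys₁ p

    ∑≤length-by-injection : ∀ (xs : List A) (ys : List B) (t : A → ℕ) (φ : A → B) → Unique xs →
      (∀ {x} → x ∈ xs → t x ≤ 1) →
      (∀ {x} → x ∈ xs → 1 ≤ t x → φ x ∈ ys) →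
      (∀ {x y} → x ∈ xs → y ∈ xs → 1 ≤ t x → 1 ≤ t y → φ x ≡ φ y → x ≡ y) →
      ∑ xs t ≤ length ys
    ∑≤length-by-injection []       ys t φ _           t≤1 φ∈ φ-inj = z≤n
    ∑≤length-by-injection (x ∷ xs) ys t φ (x∉ ∷ uniq) t≤1 φ∈ φ-inj with t x in tx
    ... | zero = ∑≤length-by-injection xs ys t φ uniq (t≤1 ∘ there) (φ∈ ∘ there)
                   (λ p q → φ-inj (there p) (there q))
    ... | suc (suc _) with s≤s () ← subst (_≤ 1) tx (t≤1 (here refl))
    ... | suc zero with ∈-∃++ (φ∈ (here refl) (≤-reflexive (sym tx)))
    ...   | ys₁ , ys₂ , refl =
          subst (1 + ∑ xs t ≤_) length-removed
            (s≤s (∑≤length-by-injection xs (ys₁ ++ ys₂) t φ uniq (λ p → t≤1 (there p))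
               (λ {y} p ty → ∈-remove ys₁ ys₂ (φ∈ (there p) ty)
                  (λ φy≡φx → lookup x∉ p (φ-inj (here refl) (there p) (≤-reflexive (sym tx)) ty (sym φy≡φx))))
               (λ p q → φ-inj (there p) (there q))))
      where
      length-removed : suc (length (ys₁ ++ ys₂)) ≡ length (ys₁ ++ φ x ∷ ys₂)
      length-removed = trans (cong suc (List.length-++ ys₁))
        (trans (sym (+-suc (length ys₁) (length ys₂))) (sym (List.length-++ ys₁)))


module Windows where

  open import Data.Nat
  open import Data.Nat.Properties
  open import Data.List using (downFrom)
  open import Data.Product using (_×_; _,_)
  open import Relation.Binary.PropositionalEquality
  open import Relation.Nullary using (Dec; yes; no)
  open import Relation.Nullary.Decidable using (_×-dec_)
  open import Data.Empty using (⊥-elim)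
  open BigSum

  χ : ∀ {P : Set} → Dec P → ℕ
  χ (yes _) = 1
  χ (no _)  = 0

  χ≤1 : ∀ {P : Set} (d : Dec P) → χ d ≤ 1
  χ≤1 (yes _) = s≤s z≤n
  χ≤1 (no _)  = z≤n

  χ-witness : ∀ {P : Set} (d : Dec P) → 1 ≤ χ d → P
  χ-witness (yes p) _ = p

  χ-×-dec : ∀ {P Q : Set} (p? : Dec P) (q? : Dec Q) → χ (p? ×-dec q?) ≡ χ p? * χ q?
  χ-×-dec (yes _) (yes _) = refl
  χ-×-dec (yes _) (no _)  = refl
  χ-×-dec (no _)  _       = refl

  InWindow : ℕ → ℕ → ℕ → Set
  InWindow k α U = U ≤ α × α < U + k

  inWindow? : ∀ k α U → Dec (InWindow k α U)
  inWindow? k α U = (U ≤? α) ×-dec (α <? U + k)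

  inWindow⇒offset< : ∀ {k α U} → InWindow k α U → α ∸ U < k
  inWindow⇒offset< {k} {α} {U} (U≤α , α<U+k) = subst (α ∸ U <_) (m+n∸m≡n U k) (∸-monoˡ-< α<U+k U≤α)

  windowCount : ℕ → ℕ → ℕ → ℕ
  windowCount k U N = ∑ (downFrom N) (λ α → χ (inWindow? k α U))

  windowCount-below : ∀ k U N → N ≤ U → windowCount k U N ≡ 0
  windowCount-below k U zero    _   = refl
  windowCount-below k U (suc N) N<U with inWindow? k N U
  ... | yes (U≤N , _) = ⊥-elim (<⇒≱ N<U U≤N)
  ... | no _          = windowCount-below k U N (<⇒≤ N<U)

  windowCount-inside : ∀ k U j → j ≤ k → windowCount k U (U + j) ≡ j
  windowCount-inside k U zero    _   rewrite +-identityʳ U = windowCount-below k U U ≤-refl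
  windowCount-inside k U (suc j) j<k rewrite +-suc U j with inWindow? k (U + j) U
  ... | yes _  = cong suc (windowCount-inside k U j (<⇒≤ j<k))
  ... | no ¬in = ⊥-elim (¬in (m≤m+n U j , +-monoʳ-< U j<k))

  windowCount-above : ∀ k U e → windowCount k U (U + k + e) ≡ k
  windowCount-above k U zero    rewrite +-identityʳ (U + k) = windowCount-inside k U k ≤-refl
  windowCount-above k U (suc e) rewrite +-suc (U + k) e with inWindow? k (U + k + e) U
  ... | yes (_ , lt) = ⊥-elim (<⇒≱ lt (m≤m+n (U + k) e))
  ... | no _         = windowCount-above k U e

  windowCount-full : ∀ k U r → U ≤ r → windowCount k U (r + k) ≡ k
  windowCount-full k U r U≤r = subst (λ N → windowCount k U N ≡ k) U+k+[r∸U]≡r+k (windowCount-above k U (r ∸ U))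
    where
    U+k+[r∸U]≡r+k : U + k + (r ∸ U) ≡ r + k
    U+k+[r∸U]≡r+k = begin
      U + k + (r ∸ U)   ≡⟨ +-assoc U k (r ∸ U) ⟩
      U + (k + (r ∸ U)) ≡⟨ cong (U +_) (+-comm k (r ∸ U)) ⟩
      U + ((r ∸ U) + k) ≡⟨ sym (+-assoc U (r ∸ U) k) ⟩
      U + (r ∸ U) + k   ≡⟨ cong (_+ k) (m+[n∸m]≡n U≤r) ⟩
      r + k             ∎
      where open ≡-Reasoning


module Rotation where

  open import Defs using (Point; dist; diff)
  import Data.Nat as ℕ
  open import Data.Integer
  open import Data.Integer.Properties
  open import Data.Integer.Tactic.RingSolver using (solve-∀)
  open import Data.Product using (_×_; _,_; proj₁; proj₂; ∃-syntax)
  open import Relation.Binary.PropositionalEquality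
  open ≡-Reasoning

  u v : Point → ℤ
  u (x , y) = x + y
  v (x , y) = x - y

  ∣Δu∣≤dist : ∀ p q → ∣ u q - u p ∣ ℕ.≤ dist p q
  ∣Δu∣≤dist (x₁ , y₁) (x₂ , y₂) =
    subst (λ z → ∣ z ∣ ℕ.≤ dist (x₁ , y₁) (x₂ , y₂)) (sym (regroup x₂ y₂ x₁ y₁)) (∣i+j∣≤∣i∣+∣j∣ (x₂ - x₁) (y₂ - y₁))
    where regroup : ∀ a b c d → (a + b) - (c + d) ≡ (a - c) + (b - d)
          regroup = solve-∀

  ∣Δv∣≤dist : ∀ p q → ∣ v q - v p ∣ ℕ.≤ dist p q
  ∣Δv∣≤dist (x₁ , y₁) (x₂ , y₂) =
    subst (λ z → ∣ z ∣ ℕ.≤ dist (x₁ , y₁) (x₂ , y₂)) (sym (regroup x₂ y₂ x₁ y₁)) (∣i-j∣≤∣i∣+∣j∣ (x₂ - x₁) (y₂ - y₁))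
    where regroup : ∀ a b c d → (a - b) - (c - d) ≡ (a - c) - (b - d)
          regroup = solve-∀

  Δv-parity : ∀ a b c d → u a - u b ≡ u c - u d → ∃[ w ] v a - v b ≡ (v c - v d) + (w + w)
  Δv-parity (xa , ya) (xb , yb) (xc , yc) (xd , yd) Δu≡ = (yc - yd) - (ya - yb) , (begin
      (xa - ya) - (xb - yb)                      ≡⟨ via-u xa ya xb yb ⟩
      ((xa + ya) - (xb + yb)) - + 2 * (ya - yb)  ≡⟨ cong (_- + 2 * (ya - yb)) Δu≡ ⟩
      ((xc + yc) - (xd + yd)) - + 2 * (ya - yb)  ≡⟨ back xc yc xd yd ya yb ⟩
      ((xc - yc) - (xd - yd)) + (((yc - yd) - (ya - yb)) + ((yc - yd) - (ya - yb))) ∎)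
    where
    via-u : ∀ a b c d → (a - b) - (c - d) ≡ ((a + b) - (c + d)) - + 2 * (b - d)
    via-u = solve-∀
    back : ∀ a b c d e f → ((a + b) - (c + d)) - + 2 * (e - f) ≡ ((a - b) - (c - d)) + (((b - d) - (e - f)) + ((b - d) - (e - f)))
    back = solve-∀

  sum-difference-injective : ∀ {a b c d : ℤ} → a + b ≡ c + d → a - b ≡ c - d → a ≡ c × b ≡ d
  sum-difference-injective {a} {b} {c} {d} sum≡ dif≡ =
      *-cancelˡ-≡ (+ 2) a c (begin
        + 2 * a            ≡⟨ twice-first a b ⟩
        (a + b) + (a - b)  ≡⟨ cong₂ _+_ sum≡ dif≡ ⟩
        (c + d) + (c - d)  ≡⟨ twice-first c d ⟨
        + 2 * c            ∎)
    , *-cancelˡ-≡ (+ 2) b d (begin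
        + 2 * b            ≡⟨ twice-second a b ⟩
        (a + b) - (a - b)  ≡⟨ cong₂ _-_ sum≡ dif≡ ⟩
        (c + d) - (c - d)  ≡⟨ twice-second c d ⟨
        + 2 * d            ∎)
    where
    twice-first : ∀ a b → + 2 * a ≡ (a + b) + (a - b)
    twice-first = solve-∀
    twice-second : ∀ a b → + 2 * b ≡ (a + b) - (a - b)
    twice-second = solve-∀

  Δu-Δv-determine-diff : ∀ a b c d → u a - u b ≡ u c - u d → v a - v b ≡ v c - v d → diff a b ≡ diff c d
  Δu-Δv-determine-diff (xa , ya) (xb , yb) (xc , yc) (xd , yd) Δu≡ Δv≡ = cong₂ _,_ (proj₁ Δxy≡) (proj₂ Δxy≡)
    where
    split-u : ∀ a b c d → (a + b) - (c + d) ≡ (a - c) + (b - d)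
    split-u = solve-∀
    split-v : ∀ a b c d → (a - b) - (c - d) ≡ (a - c) - (b - d)
    split-v = solve-∀
    Δxy≡ : (xa - xb ≡ xc - xd) × (ya - yb ≡ yc - yd)
    Δxy≡ = sum-difference-injective (trans (sym (split-u xa ya xb yb)) (trans Δu≡ (split-u xc yc xd yd)))
                                    (trans (sym (split-v xa ya xb yb)) (trans Δv≡ (split-v xc yc xd yd)))


module Offsets where

  open import Data.Nat as ℕ using (ℕ; zero; suc; ⌊_/2⌋; _∸_)
  import Data.Nat.Properties as ℕ
  open import Data.Integer using (ℤ; +_; -[1+_]; _+_; _-_; -_; ∣_∣)
  import Data.Integer as ℤ
  open import Data.Integer.Properties
  open import Data.Integer.Tactic.RingSolver using (solve-∀)
  open import Relation.Binary.PropositionalEquality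
  open ≡-Reasoning

  ⌊m+m+n/2⌋≡m+⌊n/2⌋ : ∀ m n → ⌊ m ℕ.+ m ℕ.+ n /2⌋ ≡ m ℕ.+ ⌊ n /2⌋
  ⌊m+m+n/2⌋≡m+⌊n/2⌋ zero    n = refl
  ⌊m+m+n/2⌋≡m+⌊n/2⌋ (suc m) n rewrite ℕ.+-suc m m = cong suc (⌊m+m+n/2⌋≡m+⌊n/2⌋ m n)

  ⌊n/2⌋<h : ∀ n h → n ℕ.< h ℕ.+ h → ⌊ n /2⌋ ℕ.< h
  ⌊n/2⌋<h zero          (suc h) _ = ℕ.s≤s ℕ.z≤n
  ⌊n/2⌋<h (suc zero)    (suc h) _ = ℕ.s≤s ℕ.z≤n
  ⌊n/2⌋<h (suc (suc n)) (suc h) (ℕ.s≤s n<) =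
    ℕ.s≤s (⌊n/2⌋<h n h (ℕ.≤-pred (subst (suc (suc n) ℕ.≤_) (ℕ.+-suc h h) n<)))

  private
    ⌊/2⌋-injective-ℕ-gap : ∀ q q′ w → q ≡ w ℕ.+ w ℕ.+ q′ → ⌊ q /2⌋ ≡ ⌊ q′ /2⌋ → q ≡ q′
    ⌊/2⌋-injective-ℕ-gap q q′ w q≡ halves≡
      with ℕ.+-cancelʳ-≡ ⌊ q′ /2⌋ w 0 (trans (sym (⌊m+m+n/2⌋≡m+⌊n/2⌋ w q′)) (trans (cong ⌊_/2⌋ (sym q≡)) halves≡))
    ... | refl = q≡

  ⌊/2⌋-injective-even-gap : ∀ q q′ (w : ℤ) → + q ≡ + q′ + (w + w) → ⌊ q /2⌋ ≡ ⌊ q′ /2⌋ → q ≡ q′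
  ⌊/2⌋-injective-even-gap q q′ (+ w) q≡ halves≡ =
    ⌊/2⌋-injective-ℕ-gap q q′ w (trans (+-injective q≡) (ℕ.+-comm q′ (w ℕ.+ w))) halves≡
  ⌊/2⌋-injective-even-gap q q′ -[1+ w ] q≡ halves≡ =
    sym (⌊/2⌋-injective-ℕ-gap q′ q (suc w) (trans (+-injective q′≡) (ℕ.+-comm q (suc w ℕ.+ suc w))) (sym halves≡))
    where
    cancel : ∀ (a w : ℤ) → (a + (w + w)) + (- w + - w) ≡ a
    cancel = solve-∀
    q′≡ : + q′ ≡ + q + (+ suc w + + suc w)
    q′≡ = trans (sym (cancel (+ q′) -[1+ w ])) (cong (_+ (+ suc w + + suc w)) (sym q≡))

  +[a∸b]≡+a-+b : ∀ {a b} → b ℕ.≤ a → + (a ∸ b) ≡ + a - + b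
  +[a∸b]≡+a-+b {a} {b} b≤a = trans (sym (⊖-≥ b≤a)) (sym (m-n≡m⊖n a b))

  offset-difference : ∀ {a c d} → c ℕ.≤ a → d ℕ.≤ a → + (a ∸ d) - + (a ∸ c) ≡ + c - + d
  offset-difference {a} {c} {d} c≤a d≤a = begin
    + (a ∸ d) - + (a ∸ c)         ≡⟨ cong₂ _-_ (+[a∸b]≡+a-+b d≤a) (+[a∸b]≡+a-+b c≤a) ⟩
    (+ a - + d) - (+ a - + c)     ≡⟨ cancel (+ a) (+ c) (+ d) ⟩
    + c - + d                     ∎
    where cancel : ∀ a c d → (a - d) - (a - c) ≡ c - d
          cancel = solve-∀

  offset-shift : ∀ {a c d} → c ℕ.≤ a → d ℕ.≤ a → + (a ∸ d) ≡ + (a ∸ c) + (+ c - + d)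
  offset-shift {a} {c} {d} c≤a d≤a = begin
    + (a ∸ d)                     ≡⟨ +[a∸b]≡+a-+b d≤a ⟩
    + a - + d                     ≡⟨ telescope (+ a) (+ c) (+ d) ⟩
    (+ a - + c) + (+ c - + d)     ≡⟨ cong (_+ (+ c - + d)) (+[a∸b]≡+a-+b c≤a) ⟨
    + (a ∸ c) + (+ c - + d)       ∎
    where telescope : ∀ a c d → a - d ≡ (a - c) + (c - d)
          telescope = solve-∀

  offsets⇒difference : ∀ {a c d a′ c′ d′} → c ℕ.≤ a → d ℕ.≤ a → c′ ℕ.≤ a′ → d′ ℕ.≤ a′ →
                       a ∸ c ≡ a′ ∸ c′ → a ∸ d ≡ a′ ∸ d′ → + c - + d ≡ + c′ - + d′
  offsets⇒difference {a} {c} {d} {a′} {c′} {d′} c≤a d≤a c′≤a′ d′≤a′ c-offset≡ d-offset≡ = begin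
    + c - + d                     ≡⟨ offset-difference c≤a d≤a ⟨
    + (a ∸ d) - + (a ∸ c)         ≡⟨ cong₂ (λ x y → + x - + y) d-offset≡ c-offset≡ ⟩
    + (a′ ∸ d′) - + (a′ ∸ c′)     ≡⟨ offset-difference c′≤a′ d′≤a′ ⟩
    + c′ - + d′                   ∎

  shifted-difference : ∀ {a b c : ℤ} → c ℤ.≤ a → c ℤ.≤ b → + ∣ a - c ∣ - + ∣ b - c ∣ ≡ a - b
  shifted-difference {a} {b} {c} c≤a c≤b = begin
    + ∣ a - c ∣ - + ∣ b - c ∣     ≡⟨ cong₂ _-_ (0≤i⇒+∣i∣≡i (i≤j⇒0≤j-i c≤a)) (0≤i⇒+∣i∣≡i (i≤j⇒0≤j-i c≤b)) ⟩
    (a - c) - (b - c)             ≡⟨ cancel a b c ⟩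
    a - b                         ∎
    where cancel : ∀ a b c → (a - c) - (b - c) ≡ a - b
          cancel = solve-∀


module WindowCounting where

  open import Defs
  open import Data.Nat
  open import Data.Nat.Properties
  import Data.Integer as ℤ
  open ℤ using (ℤ; +_)
  import Data.Integer.Properties as ℤ
  open import Data.Fin using (Fin; zero; suc)
  import Data.Fin.Properties as Fin
  open import Data.List using (List; _++_; map; length; cartesianProduct; downFrom; allFin)
  import Data.List.Properties as List
  open import Data.List.Membership.Propositional using (_∈_)
  open import Data.List.Membership.Propositional.Properties
    using (∈-++⁺ˡ; ∈-++⁺ʳ; ∈-map⁺; ∈-cartesianProduct⁺; ∈-allFin; ∈-downFrom⁺)
  open import Data.List.Relation.Unary.Unique.Propositional.Properties using (cartesianProduct⁺; downFrom⁺; allFin⁺)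
  open import Data.Product using (_×_; _,_; proj₁; proj₂; Σ-syntax; ∃-syntax)
  open import Data.Product.Properties using (,-injectiveˡ; ,-injectiveʳ)
  open import Data.Sum using (_⊎_; inj₁; inj₂)
  open import Data.Sum.Properties using (inj₁-injective; inj₂-injective)
  open import Relation.Binary.PropositionalEquality
  open import Relation.Nullary using (¬_; Dec; yes; no)
  open import Relation.Nullary.Decidable using (_×-dec_)
  open import Data.Nat.Tactic.RingSolver using (solve-∀)
  open import Function using (_∘_)
  open BigSum
  open Counting
  open Windows
  open Rotation
  open Offsets

  WindowInequality : ℕ → ℕ → ℕ → Set
  WindowInequality m r h = 4 * (h * h) * (m * m) ≤ (r + (h + h)) * (r + (h + h)) * (2 * (h * h) + m)

  argmin : ∀ n (f : Fin (suc n) → ℤ) → Σ[ i₀ ∈ Fin (suc n) ] (∀ i → f i₀ ℤ.≤ f i)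
  argmin zero    f = zero , λ { zero → ℤ.≤-refl }
  argmin (suc n) f with argmin n (λ i → f (suc i))
  ... | j , fj≤ with f zero ℤ.≤? f (suc j)
  ... | yes f0≤fj = zero  , λ { zero → ℤ.≤-refl ; (suc i) → ℤ.≤-trans f0≤fj (fj≤ i) }
  ... | no  f0≰fj = suc j , λ { zero → ℤ.<⇒≤ (ℤ.≰⇒> f0≰fj) ; (suc i) → fj≤ i }

  module Windowed {m r} {dot : Fin m → Point} (dd : IsSquareDD m r dot) (h : ℕ)
                  (i₀ j₀ : Fin m) (u-min : ∀ i → u (dot i₀) ℤ.≤ u (dot i)) (v-min : ∀ i → v (dot j₀) ℤ.≤ v (dot i)) where

    open IsSquareDD dd

    U V : Fin m → ℕ
    U i = ℤ.∣ u (dot i) ℤ.- u (dot i₀) ∣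
    V i = ℤ.∣ v (dot i) ℤ.- v (dot j₀) ∣

    U≤r : ∀ i → U i ≤ r
    U≤r i = ≤-trans (∣Δu∣≤dist (dot i₀) (dot i)) (within i₀ i)

    V≤r : ∀ i → V i ≤ r
    V≤r i = ≤-trans (∣Δv∣≤dist (dot j₀) (dot i)) (within j₀ i)

    ΔU : ∀ i j → + U i ℤ.- + U j ≡ u (dot i) ℤ.- u (dot j)
    ΔU i j = shifted-difference (u-min i) (u-min j)

    ΔV : ∀ i j → + V i ℤ.- + V j ≡ v (dot i) ℤ.- v (dot j)
    ΔV i j = shifted-difference (v-min i) (v-min j)

    k N : ℕ
    k = h + h
    N = r + k

    Window : Set
    Window = ℕ × ℕ

    windows : List Window
    windows = cartesianProduct (downFrom N) (downFrom N)

    dots : List (Fin m)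
    dots = allFin m

    Contains : Window → Fin m → Set
    Contains (α , β) i = InWindow k α (U i) × InWindow k β (V i)

    contains? : ∀ w i → Dec (Contains w i)
    contains? (α , β) i = inWindow? k α (U i) ×-dec inWindow? k β (V i)

    load : Window → ℕ
    load w = ∑ dots (λ i → χ (contains? w i))

    ∑-windows-containing : ∀ i → ∑ windows (λ w → χ (contains? w i)) ≡ k * k
    ∑-windows-containing i = begin
      ∑ windows (λ w → χ (contains? w i))
        ≡⟨ ∑-cartesianProduct (downFrom N) (downFrom N) (λ w → χ (contains? w i)) ⟩
      ∑ (downFrom N) (λ α → ∑ (downFrom N) (λ β → χ (contains? (α , β) i)))
        ≡⟨ ∑-cong (downFrom N) (λ α → ∑-cong (downFrom N) (λ β → χ-×-dec (inWindow? k α (U i)) (inWindow? k β (V i)))) ⟩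
      ∑ (downFrom N) (λ α → ∑ (downFrom N) (λ β → χ (inWindow? k α (U i)) * χ (inWindow? k β (V i))))
        ≡⟨ ∑*∑ (downFrom N) (downFrom N) _ _ ⟨
      windowCount k (U i) N * windowCount k (V i) N
        ≡⟨ cong₂ _*_ (windowCount-full k (U i) r (U≤r i)) (windowCount-full k (V i) r (V≤r i)) ⟩
      k * k ∎
      where open ≡-Reasoning

    ∑-load : ∑ windows load ≡ m * (k * k)
    ∑-load = begin
      ∑ windows load                                     ≡⟨ ∑-comm windows dots _ ⟩
      ∑ dots (λ i → ∑ windows (λ w → χ (contains? w i))) ≡⟨ ∑-cong dots ∑-windows-containing ⟩
      ∑ dots (λ _ → k * k)                               ≡⟨ ∑-const dots (k * k) ⟩
      length dots * (k * k)                              ≡⟨ cong (_* (k * k)) (List.length-tabulate {n = m} (λ i → i)) ⟩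
      m * (k * k)                                        ∎
      where open ≡-Reasoning

    Incidence : Set
    Incidence = Window × (Fin m × Fin m)

    incidences : List Incidence
    incidences = cartesianProduct windows (cartesianProduct dots dots)

    BothIn : Incidence → Set
    BothIn (w , (i , j)) = Contains w i × Contains w j

    bothIn? : ∀ x → Dec (BothIn x)
    bothIn? (w , (i , j)) = contains? w i ×-dec contains? w j

    ∑-load² : ∑ windows (λ w → load w * load w) ≡ ∑ incidences (λ x → χ (bothIn? x))
    ∑-load² = sym (begin
      ∑ incidences (λ x → χ (bothIn? x))
        ≡⟨ ∑-cartesianProduct windows (cartesianProduct dots dots) _ ⟩
      ∑ windows (λ w → ∑ (cartesianProduct dots dots) (λ ij → χ (bothIn? (w , ij))))
        ≡⟨ ∑-cong windows (λ w → ∑-cartesianProduct dots dots _) ⟩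
      ∑ windows (λ w → ∑ dots (λ i → ∑ dots (λ j → χ (contains? w i ×-dec contains? w j))))
        ≡⟨ ∑-cong windows (λ w → ∑-cong dots (λ i → ∑-cong dots (λ j → χ-×-dec (contains? w i) (contains? w j)))) ⟩
      ∑ windows (λ w → ∑ dots (λ i → ∑ dots (λ j → χ (contains? w i) * χ (contains? w j))))
        ≡⟨ ∑-cong windows (λ w → ∑*∑ dots dots _ _) ⟨
      ∑ windows (λ w → load w * load w) ∎)
      where open ≡-Reasoning

    Code : Set
    Code = (ℕ × ℕ × ℕ × ℕ) ⊎ (Fin m × ℕ × ℕ)

    offsets : List ℕ
    offsets = downFrom k

    distinctCodes : List (ℕ × ℕ × ℕ × ℕ)
    distinctCodes = cartesianProduct offsets (cartesianProduct offsets (cartesianProduct offsets (downFrom h)))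

    equalCodes : List (Fin m × ℕ × ℕ)
    equalCodes = cartesianProduct dots (cartesianProduct offsets offsets)

    codes : List Code
    codes = map inj₁ distinctCodes ++ map inj₂ equalCodes

    length-codes : length codes ≡ k * (k * (k * h)) + m * (k * k)
    length-codes = begin
      length codes                                                  ≡⟨ List.length-++ (map inj₁ distinctCodes) ⟩
      length (map inj₁ distinctCodes) + length (map inj₂ equalCodes) ≡⟨ cong₂ _+_ (List.length-map inj₁ distinctCodes)
                                                                                   (List.length-map inj₂ equalCodes) ⟩
      length distinctCodes + length equalCodes                      ≡⟨ cong₂ _+_ length-distinct length-equal ⟩
      k * (k * (k * h)) + m * (k * k)                               ∎
      where
      open ≡-Reasoning
      ∣offsets∣ : length offsets ≡ k
      ∣offsets∣ = List.length-downFrom k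
      length-distinct : length distinctCodes ≡ k * (k * (k * h))
      length-distinct =
        trans (length-cartesianProduct offsets _) (cong₂ _*_ ∣offsets∣
        (trans (length-cartesianProduct offsets _) (cong₂ _*_ ∣offsets∣
        (trans (length-cartesianProduct offsets (downFrom h)) (cong₂ _*_ ∣offsets∣ (List.length-downFrom h))))))
      length-equal : length equalCodes ≡ m * (k * k)
      length-equal =
        trans (length-cartesianProduct dots _) (cong₂ _*_ (List.length-tabulate {n = m} (λ i → i))
        (trans (length-cartesianProduct offsets offsets) (cong₂ _*_ ∣offsets∣ ∣offsets∣)))

    -- An incidence is coded by the offsets of its dots inside the window; for distinct dots only half of the
    -- second v-offset is kept, which is what brings the number of codes down to k³h + mk².
    code′ : ∀ α β i j → Dec (i ≡ j) → Code
    code′ α β i j (yes _) = inj₂ (i , α ∸ U i , β ∸ V i)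
    code′ α β i j (no _)  = inj₁ (α ∸ U i , β ∸ V i , α ∸ U j , ⌊ β ∸ V j /2⌋)

    code : Incidence → Code
    code ((α , β) , (i , j)) = code′ α β i j (i Fin.≟ j)

    code-∈ : ∀ x → BothIn x → code x ∈ codes
    code-∈ ((α , β) , (i , j)) ((αi , βi) , (αj , βj)) with i Fin.≟ j
    ... | yes _ = ∈-++⁺ʳ (map inj₁ distinctCodes) (∈-map⁺ inj₂ (∈-cartesianProduct⁺ (∈-allFin i)
                    (∈-cartesianProduct⁺ (∈-downFrom⁺ (inWindow⇒offset< αi)) (∈-downFrom⁺ (inWindow⇒offset< βi)))))
    ... | no _  = ∈-++⁺ˡ (∈-map⁺ inj₁ (∈-cartesianProduct⁺ (∈-downFrom⁺ (inWindow⇒offset< αi))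
                    (∈-cartesianProduct⁺ (∈-downFrom⁺ (inWindow⇒offset< βi))
                      (∈-cartesianProduct⁺ (∈-downFrom⁺ (inWindow⇒offset< αj))
                        (∈-downFrom⁺ (⌊n/2⌋<h _ h (inWindow⇒offset< βj)))))))

    window-determined : ∀ {α β α′ β′ i i′} → i ≡ i′ → Contains (α , β) i → Contains (α′ , β′) i′ →
                        α ∸ U i ≡ α′ ∸ U i′ → β ∸ V i ≡ β′ ∸ V i′ → (α , β) ≡ (α′ , β′)
    window-determined refl ((Ui≤α , _) , (Vi≤β , _)) ((Ui≤α′ , _) , (Vi≤β′ , _)) α-offset≡ β-offset≡ =
      cong₂ _,_ (∸-cancelʳ-≡ Ui≤α Ui≤α′ α-offset≡) (∸-cancelʳ-≡ Vi≤β Vi≤β′ β-offset≡)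

    -- The code stores only ⌊(β ∸ V j)/2⌋; the lost bit is recovered because u- and v-differences have equal parity.
    dots-determined : ∀ {α β α′ β′ i j i′ j′} →
      Contains (α , β) i → Contains (α , β) j → Contains (α′ , β′) i′ → Contains (α′ , β′) j′ →
      ¬ i ≡ j → ¬ i′ ≡ j′ → α ∸ U i ≡ α′ ∸ U i′ → β ∸ V i ≡ β′ ∸ V i′ → α ∸ U j ≡ α′ ∸ U j′ →
      ⌊ β ∸ V j /2⌋ ≡ ⌊ β′ ∸ V j′ /2⌋ → i ≡ i′ × j ≡ j′
    dots-determined {α} {β} {α′} {β′} {i} {j} {i′} {j′}
      ((Ui≤α , _) , (Vi≤β , _)) ((Uj≤α , _) , (Vj≤β , _)) ((Ui′≤α′ , _) , (Vi′≤β′ , _)) ((Uj′≤α′ , _) , (Vj′≤β′ , _))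
      i≢j i′≢j′ Ui-offset≡ Vi-offset≡ Uj-offset≡ ⌊Vj-offset/2⌋≡ =
      distinctDiffs i j i′ j′ i≢j i′≢j′ (Δu-Δv-determine-diff (dot i) (dot j) (dot i′) (dot j′) Δu≡ Δv≡)
      where
      open ≡-Reasoning
      Δv : Fin m → Fin m → ℤ
      Δv a b = v (dot a) ℤ.- v (dot b)
      Δu≡ : u (dot i) ℤ.- u (dot j) ≡ u (dot i′) ℤ.- u (dot j′)
      Δu≡ = trans (sym (ΔU i j)) (trans (offsets⇒difference Ui≤α Uj≤α Ui′≤α′ Uj′≤α′ Ui-offset≡ Uj-offset≡) (ΔU i′ j′))
      Δv-gap : ∃[ w ] Δv i j ≡ Δv i′ j′ ℤ.+ (w ℤ.+ w)
      Δv-gap = Δv-parity (dot i) (dot j) (dot i′) (dot j′) Δu≡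
      w = proj₁ Δv-gap
      Vj-offset-gap : + (β ∸ V j) ≡ + (β′ ∸ V j′) ℤ.+ (w ℤ.+ w)
      Vj-offset-gap = begin
        + (β ∸ V j)                                ≡⟨ offset-shift Vi≤β Vj≤β ⟩
        + (β ∸ V i) ℤ.+ (+ V i ℤ.- + V j)          ≡⟨ cong₂ ℤ._+_ (cong +_ Vi-offset≡) (ΔV i j) ⟩
        + (β′ ∸ V i′) ℤ.+ Δv i j                   ≡⟨ cong (λ z → + (β′ ∸ V i′) ℤ.+ z) (proj₂ Δv-gap) ⟩
        + (β′ ∸ V i′) ℤ.+ (Δv i′ j′ ℤ.+ (w ℤ.+ w)) ≡⟨ ℤ.+-assoc (+ (β′ ∸ V i′)) (Δv i′ j′) (w ℤ.+ w) ⟨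
        + (β′ ∸ V i′) ℤ.+ Δv i′ j′ ℤ.+ (w ℤ.+ w)   ≡⟨ cong (λ z → + (β′ ∸ V i′) ℤ.+ z ℤ.+ (w ℤ.+ w)) (ΔV i′ j′) ⟨
        + (β′ ∸ V i′) ℤ.+ (+ V i′ ℤ.- + V j′) ℤ.+ (w ℤ.+ w)
                                                   ≡⟨ cong (ℤ._+ (w ℤ.+ w)) (offset-shift Vi′≤β′ Vj′≤β′) ⟨
        + (β′ ∸ V j′) ℤ.+ (w ℤ.+ w)                ∎
      Vj-offset≡ : β ∸ V j ≡ β′ ∸ V j′
      Vj-offset≡ = ⌊/2⌋-injective-even-gap _ _ w Vj-offset-gap ⌊Vj-offset/2⌋≡
      Δv≡ : Δv i j ≡ Δv i′ j′
      Δv≡ = trans (sym (ΔV i j)) (trans (offsets⇒difference Vi≤β Vj≤β Vi′≤β′ Vj′≤β′ Vi-offset≡ Vj-offset≡) (ΔV i′ j′))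

    distinct-code-injective : ∀ {α β α′ β′ i j i′ j′} →
      Contains (α , β) i → Contains (α , β) j → Contains (α′ , β′) i′ → Contains (α′ , β′) j′ → ¬ i ≡ j → ¬ i′ ≡ j′ →
      (α ∸ U i , β ∸ V i , α ∸ U j , ⌊ β ∸ V j /2⌋) ≡ (α′ ∸ U i′ , β′ ∸ V i′ , α′ ∸ U j′ , ⌊ β′ ∸ V j′ /2⌋) →
      ((α , β) , (i , j)) ≡ ((α′ , β′) , (i′ , j′))
    distinct-code-injective in-i in-j in-i′ in-j′ i≢j i′≢j′ offsets≡ =
      cong₂ _,_ (window-determined i≡i′ in-i in-i′ Ui≡ Vi≡) (cong₂ _,_ i≡i′ j≡j′)
      where
      Ui≡ = ,-injectiveˡ offsets≡
      Vi≡ = ,-injectiveˡ (,-injectiveʳ offsets≡)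
      Uj≡ = ,-injectiveˡ (,-injectiveʳ (,-injectiveʳ offsets≡))
      ⌊Vj/2⌋≡ = ,-injectiveʳ (,-injectiveʳ (,-injectiveʳ offsets≡))
      dots≡ = dots-determined in-i in-j in-i′ in-j′ i≢j i′≢j′ Ui≡ Vi≡ Uj≡ ⌊Vj/2⌋≡
      i≡i′ = proj₁ dots≡
      j≡j′ = proj₂ dots≡

    code-injective : ∀ {x y} → BothIn x → BothIn y → code x ≡ code y → x ≡ y
    code-injective {(α , β) , (i , j)} {(α′ , β′) , (i′ , j′)} (in-i , _) (in-i′ , _) code≡
      with i Fin.≟ j | i′ Fin.≟ j′
    ... | yes refl | yes refl =
      cong₂ _,_ (window-determined i≡i′ in-i in-i′ (,-injectiveˡ offsets≡) (,-injectiveʳ offsets≡)) (cong₂ _,_ i≡i′ i≡i′)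
      where
      i≡i′ = ,-injectiveˡ (inj₂-injective code≡)
      offsets≡ = ,-injectiveʳ (inj₂-injective code≡)
    code-injective _ _ () | yes _ | no _
    code-injective _ _ () | no _  | yes _
    code-injective (in-i , in-j) (in-i′ , in-j′) code≡ | no i≢j | no i′≢j′ =
      distinct-code-injective in-i in-j in-i′ in-j′ i≢j i′≢j′ (inj₁-injective code≡)

    ∑-load²≤ : ∑ windows (λ w → load w * load w) ≤ k * (k * (k * h)) + m * (k * k)
    ∑-load²≤ = subst₂ _≤_ (sym ∑-load²) length-codes
      (∑≤length-by-injection incidences codes (λ x → χ (bothIn? x)) code
        (cartesianProduct⁺ (cartesianProduct⁺ (downFrom⁺ N) (downFrom⁺ N)) (cartesianProduct⁺ (allFin⁺ m) (allFin⁺ m)))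
        (λ {x} _ → χ≤1 (bothIn? x))
        (λ {x} _ 1≤χ → code-∈ x (χ-witness (bothIn? x) 1≤χ))
        (λ {x} {y} _ _ 1≤χx 1≤χy → code-injective (χ-witness (bothIn? x) 1≤χx) (χ-witness (bothIn? y) 1≤χy)))

    counting-inequality : (m * (k * k)) * (m * (k * k)) ≤ (N * N) * (k * (k * (k * h)) + m * (k * k))
    counting-inequality = begin
      (m * (k * k)) * (m * (k * k))                         ≡⟨ cong₂ _*_ ∑-load ∑-load ⟨
      ∑ windows load * ∑ windows load                       ≤⟨ cauchy-schwarz windows load ⟩
      length windows * ∑ windows (λ w → load w * load w)    ≤⟨ *-monoʳ-≤ (length windows) ∑-load²≤ ⟩
      length windows * (k * (k * (k * h)) + m * (k * k))    ≡⟨ cong (_* (k * (k * (k * h)) + m * (k * k))) length-windows ⟩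
      (N * N) * (k * (k * (k * h)) + m * (k * k))           ∎
      where
      open ≤-Reasoning
      length-windows : length windows ≡ N * N
      length-windows = trans (length-cartesianProduct (downFrom N) (downFrom N))
                             (cong₂ _*_ (List.length-downFrom N) (List.length-downFrom N))

  window-inequality : ∀ {m r} → SquareDDExists m r → ∀ h → 1 ≤ h → WindowInequality m r h
  window-inequality {zero} _ h _ rewrite *-zeroʳ (4 * (h * h)) = z≤n
  window-inequality {suc m} {r} (witness dot dd) h@(suc _) _ =
    *-cancelˡ-≤ (4 * (h * h)) (subst₂ _≤_ (lhs (suc m) h) (rhs (suc m) h r) W.counting-inequality)
    where
    module W = Windowed dd h (proj₁ (argmin m (u ∘ dot))) (proj₁ (argmin m (v ∘ dot)))
                             (proj₂ (argmin m (u ∘ dot))) (proj₂ (argmin m (v ∘ dot)))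
    lhs : ∀ m h → (m * ((h + h) * (h + h))) * (m * ((h + h) * (h + h))) ≡ 4 * (h * h) * (4 * (h * h) * (m * m))
    lhs = solve-∀
    rhs : ∀ m h r → ((r + (h + h)) * (r + (h + h))) * ((h + h) * ((h + h) * ((h + h) * h)) + m * ((h + h) * (h + h)))
                    ≡ 4 * (h * h) * ((r + (h + h)) * (r + (h + h)) * (2 * (h * h) + m))
    rhs = solve-∀


module Powers where

  open import Data.Nat
  open import Data.Nat.Properties
  open import Data.Product using (_×_; _,_; ∃-syntax)
  open import Relation.Binary.PropositionalEquality using (_≡_; refl)
  open import Relation.Nullary using (¬_; yes; no)
  open import Relation.Unary using (Decidable)
  open import Data.Empty using (⊥-elim)
  open import Data.Nat.Tactic.RingSolver using (solve-∀)

  sq cb : ℕ → ℕ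
  sq x = x * x
  cb x = x * x * x

  sq-mono-≤ : ∀ {x y} → x ≤ y → sq x ≤ sq y
  sq-mono-≤ x≤y = *-mono-≤ x≤y x≤y

  cb-mono-≤ : ∀ {x y} → x ≤ y → cb x ≤ cb y
  cb-mono-≤ x≤y = *-mono-≤ (*-mono-≤ x≤y x≤y) x≤y

  sq-mono-< : ∀ {x y} → x < y → sq x < sq y
  sq-mono-< x<y = *-mono-< x<y x<y

  cb-mono-< : ∀ {x y} → x < y → cb x < cb y
  cb-mono-< x<y = *-mono-< (*-mono-< x<y x<y) x<y

  sq-cancel-< : ∀ x y → sq x < sq y → x < y
  sq-cancel-< x y x²<y² = ≰⇒> (λ y≤x → <⇒≱ x²<y² (sq-mono-≤ y≤x))

  sq-cancel-≤ : ∀ x y → sq x ≤ sq y → x ≤ y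
  sq-cancel-≤ x y x²≤y² = ≮⇒≥ (λ y<x → <⇒≱ (sq-mono-< y<x) x²≤y²)

  cb-cancel-< : ∀ x y → cb x < cb y → x < y
  cb-cancel-< x y x³<y³ = ≰⇒> (λ y≤x → <⇒≱ x³<y³ (cb-mono-≤ y≤x))

  cb-cancel-≤ : ∀ x y → cb x ≤ cb y → x ≤ y
  cb-cancel-≤ x y x³≤y³ = ≮⇒≥ (λ y<x → <⇒≱ (cb-mono-< y<x) x³≤y³)

  [1+t]²≤2t² : ∀ {t} → 3 ≤ t → sq (suc t) ≤ 2 * sq t
  [1+t]²≤2t² {t} 3≤t with d , refl ← m≤n⇒∃[o]m+o≡n 3≤t = begin
    sq (suc (3 + d))                        ≤⟨ m≤m+n _ _ ⟩
    sq (suc (3 + d)) + (2 + 4 * d + d * d)  ≡⟨ identity d ⟩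
    2 * sq (3 + d)                          ∎
    where open ≤-Reasoning
          identity : ∀ d → (suc (3 + d)) * (suc (3 + d)) + (2 + 4 * d + d * d) ≡ 2 * ((3 + d) * (3 + d))
          identity = solve-∀

  threshold : (P : ℕ → Set) → Decidable P → ∀ N → P 0 → ¬ P N → ∃[ n ] P n × ¬ P (suc n)
  threshold P P? zero    P0 ¬PN = ⊥-elim (¬PN P0)
  threshold P P? (suc N) P0 ¬PN with P? N
  ... | yes PN  = N , PN , ¬PN
  ... | no ¬PN′ = threshold P P? N P0 ¬PN′


module Optimisation where

  open import Data.Nat
  open import Data.Nat.Properties
  open import Data.Product using (_,_; proj₁; proj₂)
  open import Relation.Binary.PropositionalEquality
  open import Relation.Nullary using (¬_; yes; no)
  open import Data.Nat.Tactic.RingSolver using (solve-∀)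
  open Powers
  open WindowCounting using (WindowInequality)
  open ≤-Reasoning

  -- K = 1024 · 3⁴ bounds 2r³ / (t h⁴), and C is any constant with 8C ≥ K + 276 and C ≥ 201. Both are opaque:
  -- unfolded, a product such as K * t is normalised into an 82944-fold sum.
  opaque
    C K : ℕ
    C = 10500
    K = 82944

  opaque
    unfolding C K

    202≤1+C : 202 ≤ suc C
    202≤1+C = ≤ᵇ⇒≤ 202 (suc C) _

    276+K≤8C : 276 + K ≤ 8 * C
    276+K≤8C = ≤ᵇ⇒≤ (276 + K) (8 * C) _

    K≡1024*81 : K ≡ 1024 * 81
    K≡1024*81 = refl

  c³r<g³∧t³≤r⇒ct<g : ∀ c t r g → cb c * r < cb g → cb t ≤ r → c * t < g
  c³r<g³∧t³≤r⇒ct<g c t r g c³r<g³ t³≤r = cb-cancel-< (c * t) g (begin-strict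
    cb (c * t)   ≡⟨ identity c t ⟩
    cb c * cb t  ≤⟨ *-monoʳ-≤ (cb c) t³≤r ⟩
    cb c * r     <⟨ c³r<g³ ⟩
    cb g         ∎)
    where identity : ∀ c t → (c * t) * (c * t) * (c * t) ≡ (c * c * c) * (t * t * t)
          identity = solve-∀

  -- t = ⌊r^(1/3)⌋, 1 + w = ⌈(r²/16)^(1/3)⌉ and h = ⌊(r⁴/32)^(1/6)⌋; h is the window half-width used below.
  record Scales (r : ℕ) : Set where
    field
      t w h       : ℕ
      t³≤r        : cb t ≤ r
      r<[1+t]³    : r < cb (suc t)
      16w³<r²     : 16 * cb w < sq r
      r²≤16[1+w]³ : sq r ≤ 16 * cb (suc w)
      32h⁶≤r⁴     : 32 * sq (cb h) ≤ sq (sq r)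
      r⁴<32[1+h]⁶ : sq (sq r) < 32 * sq (cb (suc h))

  scales : ∀ r → 1 ≤ r → Scales r
  scales r 1≤r = record
    { t = proj₁ t-search ; w = proj₁ w-search ; h = proj₁ h-search
    ; t³≤r = proj₁ (proj₂ t-search) ; r<[1+t]³ = ≰⇒> (proj₂ (proj₂ t-search))
    ; 16w³<r² = proj₁ (proj₂ w-search) ; r²≤16[1+w]³ = ≮⇒≥ (proj₂ (proj₂ w-search))
    ; 32h⁶≤r⁴ = proj₁ (proj₂ h-search) ; r⁴<32[1+h]⁶ = ≰⇒> (proj₂ (proj₂ h-search))
    }
    where
    instance _ = >-nonZero 1≤r
    t-search = threshold (λ n → cb n ≤ r) (λ n → cb n ≤? r) (suc r) z≤n
                 (<⇒≱ (≤-trans (m≤m*n (suc r) (suc r)) (m≤m*n (suc r * suc r) (suc r))))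
    w-search = threshold (λ n → 16 * cb n < sq r) (λ n → 16 * cb n <? sq r) r (*-mono-≤ 1≤r 1≤r)
                 (λ 16r³<r² → <⇒≱ 16r³<r² (≤-trans (m≤m*n (sq r) r) (m≤n*m (cb r) 16)))
    h-search = threshold (λ n → 32 * sq (cb n) ≤ sq (sq r)) (λ n → 32 * sq (cb n) ≤? sq (sq r)) r z≤n
                 (<⇒≱ (begin-strict
                   sq (sq r)       ≤⟨ sq-mono-≤ (m≤m*n (sq r) r) ⟩
                   sq (cb r)       <⟨ m<m*n (sq (cb r)) 32 {{>-nonZero (sq-mono-≤ (cb-mono-≤ 1≤r))}} (≤ᵇ⇒≤ 2 32 _) ⟩
                   sq (cb r) * 32  ≡⟨ *-comm (sq (cb r)) 32 ⟩
                   32 * sq (cb r)  ∎))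

  window-inequality⇒sq-bound : ∀ {m r h} X → 8 * sq h * m ≡ X + sq (r + (h + h)) → WindowInequality m r h →
                               sq X ≤ 32 * sq (sq h) * sq (r + (h + h)) + sq (sq (r + (h + h)))
  window-inequality⇒sq-bound {m} {r} {h} X 8h²m≡X+S window =
    +-cancelʳ-≤ (2 * X * S + sq S) _ _ (begin
      sq X + (2 * X * S + sq S)                         ≡⟨ expand X S ⟩
      sq (X + S)                                        ≡⟨ cong sq 8h²m≡X+S ⟨
      sq (8 * sq h * m)                                 ≡⟨ factor h m ⟩
      16 * sq h * (4 * (h * h) * (m * m))               ≤⟨ *-monoʳ-≤ (16 * sq h) window ⟩
      16 * sq h * (S * (2 * (h * h) + m))               ≡⟨ distribute h m S ⟩
      32 * sq (sq h) * S + 2 * S * (8 * sq h * m)       ≡⟨ cong (λ z → 32 * sq (sq h) * S + 2 * S * z) 8h²m≡X+S ⟩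
      32 * sq (sq h) * S + 2 * S * (X + S)              ≡⟨ regroup (sq (sq h)) S X ⟩
      32 * sq (sq h) * S + sq S + (2 * X * S + sq S)    ∎)
    where
    S = sq (r + (h + h))
    expand : ∀ x s → x * x + (2 * x * s + s * s) ≡ (x + s) * (x + s)
    expand = solve-∀
    factor : ∀ h m → (8 * (h * h) * m) * (8 * (h * h) * m) ≡ 16 * (h * h) * (4 * (h * h) * (m * m))
    factor = solve-∀
    distribute : ∀ h m s → 16 * (h * h) * (s * (2 * (h * h) + m)) ≡ 32 * ((h * h) * (h * h)) * s + 2 * s * (8 * (h * h) * m)
    distribute = solve-∀
    regroup : ∀ a s x → 32 * a * s + 2 * s * (x + s) ≡ 32 * a * s + s * s + (2 * x * s + s * s)
    regroup = solve-∀

  -- With P = 8h²A and Q = 16h²v, each term of 32h⁴(r + 2h)² + (r + 2h)⁴ = 32h⁴r² + 128h⁴rh + 128h⁴h² + (r + 2h)⁴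
  -- is dominated by one of P², 2PQ, Q², 2PY in the expansion of (P + Q + Y)².
  sq-bound-violated : ∀ {r h A v t Y} → 1 ≤ h → sq r < 2 * sq A → r < 2 * A → sq h ≤ 2 * sq v → 2 * h ≤ r →
    2 * cb r ≤ sq (sq h) * K * t → K * t * sq h ≤ Y →
    32 * sq (sq h) * sq (r + (h + h)) + sq (sq (r + (h + h))) < sq (8 * sq h * A + 16 * sq h * v + Y)
  sq-bound-violated {r} {h} {A} {v} {t} {Y} 1≤h r²<2A² r<2A h²≤2v² 2h≤r 2r³≤h⁴Kt Kth²≤Y = begin-strict
    32 * H⁴ * S + sq S                                                   <⟨ m<m+n _ (≤-trans 1≤H⁴ (m≤n*m H⁴ 32)) ⟩
    32 * H⁴ * S + sq S + 32 * H⁴                                         ≡⟨ expand h r (sq S) ⟩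
    (32 * H⁴ * sq r + 32 * H⁴) + 128 * H⁴ * (r * h) + 128 * H⁴ * sq h + sq S
                                                                         ≤⟨ +-mono-≤ (+-mono-≤ (+-mono-≤ r²-term rh-term) h²-term) S²-term ⟩
    sq P + 2 * P * Q + sq Q + 2 * P * Y                                  ≤⟨ m≤m+n _ _ ⟩
    sq P + 2 * P * Q + sq Q + 2 * P * Y + (sq Y + 2 * Q * Y)             ≡⟨ square P Q Y ⟩
    sq (P + Q + Y)                                                       ∎
    where
    H⁴ = sq (sq h)
    S = sq (r + (h + h))
    P = 8 * sq h * A
    Q = 16 * sq h * v
    1≤H⁴ : 1 ≤ H⁴
    1≤H⁴ = sq-mono-≤ (sq-mono-≤ 1≤h)
    expand : ∀ h r z → 32 * ((h * h) * (h * h)) * ((r + (h + h)) * (r + (h + h))) + z + 32 * ((h * h) * (h * h))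
             ≡ (32 * ((h * h) * (h * h)) * (r * r) + 32 * ((h * h) * (h * h))) + 128 * ((h * h) * (h * h)) * (r * h)
               + 128 * ((h * h) * (h * h)) * (h * h) + z
    expand = solve-∀
    square : ∀ p q y → p * p + 2 * p * q + q * q + 2 * p * y + (y * y + 2 * q * y) ≡ (p + q + y) * (p + q + y)
    square = solve-∀
    r²-term : 32 * H⁴ * sq r + 32 * H⁴ ≤ sq P
    r²-term = begin
      32 * H⁴ * sq r + 32 * H⁴  ≡⟨ identity H⁴ (sq r) ⟩
      32 * H⁴ * suc (sq r)      ≤⟨ *-monoʳ-≤ (32 * H⁴) r²<2A² ⟩
      32 * H⁴ * (2 * sq A)      ≡⟨ identity′ h A ⟩
      sq P                      ∎
      where identity : ∀ a s → 32 * a * s + 32 * a ≡ 32 * a * suc s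
            identity = solve-∀
            identity′ : ∀ h A → 32 * ((h * h) * (h * h)) * (2 * (A * A)) ≡ (8 * (h * h) * A) * (8 * (h * h) * A)
            identity′ = solve-∀
    rh≤2Av : r * h ≤ 2 * A * v
    rh≤2Av = sq-cancel-≤ (r * h) (2 * A * v) (begin
      sq (r * h)               ≡⟨ identity r h ⟩
      sq r * sq h              ≤⟨ *-mono-≤ (<⇒≤ r²<2A²) h²≤2v² ⟩
      (2 * sq A) * (2 * sq v)  ≡⟨ identity′ A v ⟩
      sq (2 * A * v)           ∎)
      where identity : ∀ r h → (r * h) * (r * h) ≡ (r * r) * (h * h)
            identity = solve-∀
            identity′ : ∀ A v → (2 * (A * A)) * (2 * (v * v)) ≡ (2 * A * v) * (2 * A * v)
            identity′ = solve-∀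
    rh-term : 128 * H⁴ * (r * h) ≤ 2 * P * Q
    rh-term = begin
      128 * H⁴ * (r * h)      ≤⟨ *-monoʳ-≤ (128 * H⁴) rh≤2Av ⟩
      128 * H⁴ * (2 * A * v)  ≡⟨ identity h A v ⟩
      2 * P * Q               ∎
      where identity : ∀ h A v → 128 * ((h * h) * (h * h)) * (2 * A * v) ≡ 2 * (8 * (h * h) * A) * (16 * (h * h) * v)
            identity = solve-∀
    h²-term : 128 * H⁴ * sq h ≤ sq Q
    h²-term = begin
      128 * H⁴ * sq h         ≤⟨ *-monoʳ-≤ (128 * H⁴) h²≤2v² ⟩
      128 * H⁴ * (2 * sq v)   ≡⟨ identity h v ⟩
      sq Q                    ∎
      where identity : ∀ h v → 128 * ((h * h) * (h * h)) * (2 * (v * v)) ≡ (16 * (h * h) * v) * (16 * (h * h) * v)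
            identity = solve-∀
    S²-term : sq S ≤ 2 * P * Y
    S²-term = begin
      sq S                         ≤⟨ sq-mono-≤ (sq-mono-≤ (+-monoʳ-≤ r (subst (_≤ r) (sym (double h)) 2h≤r))) ⟩
      sq (sq (r + r))              ≡⟨ identity r ⟩
      8 * r * (2 * cb r)           ≤⟨ *-monoˡ-≤ (2 * cb r) (*-monoʳ-≤ 8 (<⇒≤ r<2A)) ⟩
      8 * (2 * A) * (2 * cb r)     ≤⟨ *-monoʳ-≤ (8 * (2 * A)) 2r³≤h⁴Kt ⟩
      8 * (2 * A) * (H⁴ * K * t)   ≡⟨ identity′ h A t K ⟩
      2 * P * (K * t * sq h)       ≤⟨ *-monoʳ-≤ (2 * P) Kth²≤Y ⟩
      2 * P * Y                    ∎
      where double : ∀ h → h + h ≡ 2 * h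
            double = solve-∀
            identity : ∀ r → ((r + r) * (r + r)) * ((r + r) * (r + r)) ≡ 8 * r * (2 * (r * r * r))
            identity = solve-∀
            identity′ : ∀ h A t K → 8 * (2 * A) * ((h * h) * (h * h) * K * t) ≡ 2 * (8 * (h * h) * A) * (K * t * (h * h))
            identity′ = solve-∀

  window-terms⇒contradiction : ∀ {m r h A v t} → 1 ≤ h → sq r < 2 * sq A → r < 2 * A → sq h ≤ 2 * sq v → 2 * h ≤ r →
    2 * cb r ≤ sq (sq h) * K * t → sq (r + (h + h)) + 8 * sq h * A + 16 * sq h * v + K * t * sq h ≤ 8 * sq h * m →
    ¬ WindowInequality m r h
  window-terms⇒contradiction {m} {r} {h} {A} {v} {t} 1≤h r²<2A² r<2A h²≤2v² 2h≤r 2r³≤h⁴Kt terms≤8h²m window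
    with e , e-def ← m≤n⇒∃[o]m+o≡n terms≤8h²m =
    <⇒≱ (sq-bound-violated {r} {h} {A} {v} {t} {K * t * sq h + e} 1≤h r²<2A² r<2A h²≤2v² 2h≤r 2r³≤h⁴Kt (m≤m+n (K * t * sq h) e))
        (window-inequality⇒sq-bound {m} {r} {h} (P + Q + (K * t * sq h + e))
          (trans (sym e-def) (regroup (sq (r + (h + h))) P Q (K * t * sq h) e)) window)
    where
    P = 8 * sq h * A
    Q = 16 * sq h * v
    regroup : ∀ s p q y e → s + p + q + y + e ≡ p + q + (y + e) + s
    regroup = solve-∀

  module LargeRadius {r m A B Γ : ℕ} (27≤r : 27 ≤ r) (s : Scales r)
                     (r²<2A² : sq r < 2 * sq A) (27r²<16B³ : 27 * sq r < 16 * cb B) (C³r<Γ³ : cb C * r < cb Γ)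
                     (A+B+Γ≤m+2 : A + B + Γ ≤ m + 2) where

    open Scales s public

    v : ℕ
    v = suc w

    3≤t : 3 ≤ t
    3≤t = ≮⇒≥ (λ t<3 → <⇒≱ r<[1+t]³ (≤-trans (cb-mono-≤ t<3) 27≤r))

    1≤t : 1 ≤ t
    1≤t = ≤-trans (s≤s z≤n) 3≤t

    1≤h : 1 ≤ h
    1≤h = ≮⇒≥ (λ h<1 → <⇒≱ (begin-strict
      sq (sq r)             <⟨ r⁴<32[1+h]⁶ ⟩
      32 * sq (cb (suc h))  ≤⟨ *-monoʳ-≤ 32 (sq-mono-≤ {cb (suc h)} {cb 1} (cb-mono-≤ {suc h} {1} h<1)) ⟩
      32 * sq (cb 1)        ∎) 32≤r⁴)
      where
      729≤r² : 729 ≤ sq r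
      729≤r² = sq-mono-≤ 27≤r
      32≤r⁴ : 32 ≤ sq (sq r)
      32≤r⁴ = ≤-trans (≤ᵇ⇒≤ 32 729 _) (≤-trans 729≤r² (m≤m*n (sq r) (sq r) {{>-nonZero (≤-trans (s≤s z≤n) 729≤r²)}}))

    3w<B : 3 * w < B
    3w<B = cb-cancel-< (3 * w) B (*-cancelˡ-< 16 _ _ (begin-strict
      16 * cb (3 * w)   ≡⟨ identity w ⟩
      27 * (16 * cb w)  <⟨ *-monoʳ-< 27 16w³<r² ⟩
      27 * sq r         <⟨ 27r²<16B³ ⟩
      16 * cb B         ∎))
      where identity : ∀ w → 16 * ((3 * w) * (3 * w) * (3 * w)) ≡ 27 * (16 * (w * w * w))
            identity = solve-∀

    r<2A : r < 2 * A
    r<2A = sq-cancel-< r (2 * A) (begin-strict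
      sq r                 <⟨ r²<2A² ⟩
      2 * sq A             ≤⟨ m≤m+n (2 * sq A) (2 * sq A) ⟩
      2 * sq A + 2 * sq A  ≡⟨ identity A ⟩
      sq (2 * A)           ∎)
      where identity : ∀ A → 2 * (A * A) + 2 * (A * A) ≡ (2 * A) * (2 * A)
            identity = solve-∀


    Ct<Γ : C * t < Γ
    Ct<Γ = c³r<g³∧t³≤r⇒ct<g C t r Γ C³r<Γ³ t³≤r

    h²≤2v² : sq h ≤ 2 * sq v
    h²≤2v² = cb-cancel-≤ (sq h) (2 * sq v) (*-cancelˡ-≤ 32 (begin
      32 * cb (sq h)      ≡⟨ identity h ⟩
      32 * sq (cb h)      ≤⟨ 32h⁶≤r⁴ ⟩
      sq (sq r)           ≤⟨ sq-mono-≤ r²≤16[1+w]³ ⟩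
      sq (16 * cb v)      ≡⟨ identity′ v ⟩
      32 * cb (2 * sq v)  ∎))
      where identity : ∀ h → 32 * ((h * h) * (h * h) * (h * h)) ≡ 32 * ((h * h * h) * (h * h * h))
            identity = solve-∀
            identity′ : ∀ v → (16 * (v * v * v)) * (16 * (v * v * v)) ≡ 32 * ((2 * (v * v)) * (2 * (v * v)) * (2 * (v * v)))
            identity′ = solve-∀

    r²<8v[1+h]² : sq r < 8 * v * sq (suc h)
    r²<8v[1+h]² = cb-cancel-< (sq r) (8 * v * sq (suc h)) (begin-strict
      cb (sq r)                              ≡⟨ identity r ⟩
      sq r * sq (sq r)                       ≤⟨ *-monoˡ-≤ (sq (sq r)) r²≤16[1+w]³ ⟩
      (16 * cb v) * sq (sq r)                <⟨ *-monoʳ-< (16 * cb v) r⁴<32[1+h]⁶ ⟩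
      (16 * cb v) * (32 * sq (cb (suc h)))   ≡⟨ identity′ v (suc h) ⟩
      cb (8 * v * sq (suc h))                ∎)
      where identity : ∀ r → (r * r) * (r * r) * (r * r) ≡ (r * r) * ((r * r) * (r * r))
            identity = solve-∀
            identity′ : ∀ v g → (16 * (v * v * v)) * (32 * ((g * g * g) * (g * g * g)))
                                ≡ (8 * v * (g * g)) * (8 * v * (g * g)) * (8 * v * (g * g))
            identity′ = solve-∀

    2h≤r : 2 * h ≤ r
    2h≤r = cb-cancel-≤ (2 * h) r (sq-cancel-≤ (cb (2 * h)) (cb r) (begin
      sq (cb (2 * h))        ≡⟨ identity h ⟩
      2 * (32 * sq (cb h))   ≤⟨ *-monoʳ-≤ 2 32h⁶≤r⁴ ⟩
      2 * sq (sq r)          ≤⟨ *-monoˡ-≤ (sq (sq r)) (≤-trans (≤ᵇ⇒≤ 2 729 _) (sq-mono-≤ 27≤r)) ⟩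
      sq r * sq (sq r)       ≡⟨ identity′ r ⟩
      sq (cb r)              ∎))
      where identity : ∀ h → ((2 * h) * (2 * h) * (2 * h)) * ((2 * h) * (2 * h) * (2 * h)) ≡ 2 * (32 * ((h * h * h) * (h * h * h)))
            identity = solve-∀
            identity′ : ∀ r → (r * r) * ((r * r) * (r * r)) ≡ (r * r * r) * (r * r * r)
            identity′ = solve-∀

    w<[1+t]² : w < sq (suc t)
    w<[1+t]² = cb-cancel-< w (sq (suc t)) (begin-strict
      cb w             ≤⟨ m≤n*m (cb w) 16 ⟩
      16 * cb w        <⟨ 16w³<r² ⟩
      sq r             <⟨ sq-mono-< r<[1+t]³ ⟩
      sq (cb (suc t))  ≡⟨ identity (suc t) ⟩
      cb (sq (suc t))  ∎)
      where identity : ∀ g → (g * g * g) * (g * g * g) ≡ (g * g) * (g * g) * (g * g)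
            identity = solve-∀

    t²≤2h+1 : sq t ≤ 2 * h + 1
    t²≤2h+1 = ≤-pred (subst (sq t <_) (identity″ h)
      (cb-cancel-< (sq t) (2 * suc h) (sq-cancel-< (cb (sq t)) (cb (2 * suc h)) (begin-strict
        sq (cb (sq t))                                ≡⟨ identity t ⟩
        sq (sq (cb t))                                ≤⟨ sq-mono-≤ (sq-mono-≤ t³≤r) ⟩
        sq (sq r)                                     <⟨ r⁴<32[1+h]⁶ ⟩
        32 * sq (cb (suc h))                          ≤⟨ m≤m+n _ _ ⟩
        32 * sq (cb (suc h)) + 32 * sq (cb (suc h))   ≡⟨ identity′ (suc h) ⟩
        sq (cb (2 * suc h))                           ∎))))
      where identity : ∀ t → ((t * t) * (t * t) * (t * t)) * ((t * t) * (t * t) * (t * t))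
                             ≡ ((t * t * t) * (t * t * t)) * ((t * t * t) * (t * t * t))
            identity = solve-∀
            identity′ : ∀ g → 32 * ((g * g * g) * (g * g * g)) + 32 * ((g * g * g) * (g * g * g))
                              ≡ ((2 * g) * (2 * g) * (2 * g)) * ((2 * g) * (2 * g) * (2 * g))
            identity′ = solve-∀
            identity″ : ∀ h → 2 * suc h ≡ suc (2 * h + 1)
            identity″ = solve-∀

    r≤8t³ : r ≤ 8 * cb t
    r≤8t³ = <⇒≤ (≤-trans r<[1+t]³ (≤-trans (cb-mono-≤ (+-monoˡ-≤ t 1≤t)) (≤-reflexive (identity t))))
      where identity : ∀ t → (t + t) * (t + t) * (t + t) ≡ 8 * (t * t * t)
            identity = solve-∀

    v≤6h : v ≤ 6 * h
    v≤6h = begin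
      suc w            ≤⟨ w<[1+t]² ⟩
      sq (suc t)       ≤⟨ [1+t]²≤2t² 3≤t ⟩
      2 * sq t         ≤⟨ *-monoʳ-≤ 2 t²≤2h+1 ⟩
      2 * (2 * h + 1)  ≡⟨ identity h ⟩
      4 * h + 2        ≤⟨ +-monoʳ-≤ (4 * h) (*-monoʳ-≤ 2 1≤h) ⟩
      4 * h + 2 * h    ≡⟨ identity′ h ⟩
      6 * h            ∎
      where identity : ∀ h → 2 * (2 * h + 1) ≡ 4 * h + 2
            identity = solve-∀
            identity′ : ∀ h → 4 * h + 2 * h ≡ 6 * h
            identity′ = solve-∀

    t²≤3h : sq t ≤ 3 * h
    t²≤3h = ≤-trans t²≤2h+1 (subst (2 * h + 1 ≤_) (identity h) (+-monoʳ-≤ (2 * h) 1≤h))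
      where identity : ∀ h → 2 * h + h ≡ 3 * h
            identity = solve-∀

    r≤24th : r ≤ 24 * t * h
    r≤24th = begin
      r               ≤⟨ r≤8t³ ⟩
      8 * cb t        ≡⟨ identity t ⟩
      8 * t * sq t    ≤⟨ *-monoʳ-≤ (8 * t) t²≤3h ⟩
      8 * t * (3 * h) ≡⟨ identity′ t h ⟩
      24 * t * h      ∎
      where identity : ∀ t → 8 * (t * t * t) ≡ 8 * t * (t * t)
            identity = solve-∀
            identity′ : ∀ t h → 8 * t * (3 * h) ≡ 24 * t * h
            identity′ = solve-∀

    2r³≤h⁴Kt : 2 * cb r ≤ sq (sq h) * K * t
    2r³≤h⁴Kt = begin
      2 * cb r                    ≤⟨ *-monoʳ-≤ 2 (cb-mono-≤ r≤8t³) ⟩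
      2 * cb (8 * cb t)           ≡⟨ identity t ⟩
      1024 * t * sq (sq (sq t))   ≤⟨ *-monoʳ-≤ (1024 * t) (sq-mono-≤ (sq-mono-≤ t²≤3h)) ⟩
      1024 * t * sq (sq (3 * h))  ≡⟨ identity′ t h ⟩
      sq (sq h) * (1024 * 81) * t ≡⟨ cong (λ k → sq (sq h) * k * t) K≡1024*81 ⟨
      sq (sq h) * K * t           ∎
      where identity : ∀ t → 2 * ((8 * (t * t * t)) * (8 * (t * t * t)) * (8 * (t * t * t)))
                             ≡ 1024 * t * (((t * t) * (t * t)) * ((t * t) * (t * t)))
            identity = solve-∀
            identity′ : ∀ t h → 1024 * t * (((3 * h) * (3 * h)) * ((3 * h) * (3 * h))) ≡ (h * h) * (h * h) * (1024 * 81) * t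
            identity′ = solve-∀

    A+3v+Ct≤m+4 : A + 3 * v + C * t ≤ m + 4
    A+3v+Ct≤m+4 = begin
      A + 3 * v + C * t   ≤⟨ +-mono-≤ (+-monoʳ-≤ A 3v≤B+2) (<⇒≤ Ct<Γ) ⟩
      A + (B + 2) + Γ     ≡⟨ identity A B Γ ⟩
      (A + B + Γ) + 2     ≤⟨ +-monoˡ-≤ 2 A+B+Γ≤m+2 ⟩
      m + 2 + 2           ≡⟨ +-assoc m 2 2 ⟩
      m + 4               ∎
      where
      identity : ∀ A B Γ → A + (B + 2) + Γ ≡ A + B + Γ + 2
      identity = solve-∀
      3v≤B+2 : 3 * v ≤ B + 2
      3v≤B+2 = subst (_≤ B + 2) (identity′ w) (+-monoˡ-≤ 2 3w<B)
        where identity′ : ∀ w → suc (3 * w) + 2 ≡ 3 * suc w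
              identity′ = solve-∀

    lower-order≤8Cth² : 16 * v * h + 8 * v + 4 * r * h + 36 * sq h + K * t * sq h ≤ 8 * C * (t * sq h)
    lower-order≤8Cth² = begin
      16 * v * h + 8 * v + 4 * r * h + 36 * sq h + K * t * sq h
        ≤⟨ +-mono-≤ (+-mono-≤ (+-mono-≤ (+-mono-≤ vh-term v-term) rh-term) (*-monoʳ-≤ 36 h²≤T)) (≤-reflexive (*-assoc K t (sq h))) ⟩
      96 * T + 48 * T + 96 * T + 36 * T + K * T   ≡⟨ collect K T ⟩
      (276 + K) * T                               ≤⟨ *-monoˡ-≤ T 276+K≤8C ⟩
      8 * C * T                                   ∎
      where
      T = t * sq h
      collect : ∀ K T → 96 * T + 48 * T + 96 * T + 36 * T + K * T ≡ (276 + K) * T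
      collect = solve-∀
      h²≤T : sq h ≤ T
      h²≤T = m≤n*m (sq h) t {{>-nonZero 1≤t}}
      vh-term : 16 * v * h ≤ 96 * T
      vh-term = begin
        16 * v * h        ≤⟨ *-monoˡ-≤ h (*-monoʳ-≤ 16 v≤6h) ⟩
        16 * (6 * h) * h  ≡⟨ identity h ⟩
        96 * sq h         ≤⟨ *-monoʳ-≤ 96 h²≤T ⟩
        96 * T            ∎
        where identity : ∀ h → 16 * (6 * h) * h ≡ 96 * (h * h)
              identity = solve-∀
      v-term : 8 * v ≤ 48 * T
      v-term = begin
        8 * v        ≤⟨ *-monoʳ-≤ 8 v≤6h ⟩
        8 * (6 * h)  ≡⟨ *-assoc 8 6 h ⟨
        48 * h       ≤⟨ *-monoʳ-≤ 48 (≤-trans (m≤m*n h h {{>-nonZero 1≤h}}) h²≤T) ⟩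
        48 * T       ∎
      rh-term : 4 * r * h ≤ 96 * T
      rh-term = begin
        4 * r * h             ≤⟨ *-monoˡ-≤ h (*-monoʳ-≤ 4 r≤24th) ⟩
        4 * (24 * t * h) * h  ≡⟨ identity t h ⟩
        96 * T                ∎
        where identity : ∀ t h → 4 * (24 * t * h) * h ≡ 96 * (t * (h * h))
              identity = solve-∀

    terms≤8h²m : sq (r + (h + h)) + 8 * sq h * A + 16 * sq h * v + K * t * sq h ≤ 8 * sq h * m
    terms≤8h²m = +-cancelʳ-≤ (32 * sq h) _ _ (begin
      sq (r + (h + h)) + 8 * sq h * A + 16 * sq h * v + K * t * sq h + 32 * sq h
        ≡⟨ expand r h A v t K ⟩
      sq r + (4 * r * h + 4 * sq h + 8 * sq h * A + 16 * sq h * v + K * t * sq h + 32 * sq h)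
        ≤⟨ +-monoˡ-≤ _ (<⇒≤ r²<8v[1+h]²) ⟩
      8 * v * sq (suc h) + (4 * r * h + 4 * sq h + 8 * sq h * A + 16 * sq h * v + K * t * sq h + 32 * sq h)
        ≡⟨ regroup r h A v t K ⟩
      8 * sq h * A + 24 * sq h * v + (16 * v * h + 8 * v + 4 * r * h + 36 * sq h + K * t * sq h)
        ≤⟨ +-monoʳ-≤ (8 * sq h * A + 24 * sq h * v) lower-order≤8Cth² ⟩
      8 * sq h * A + 24 * sq h * v + 8 * C * (t * sq h)
        ≡⟨ factor h A v t C ⟩
      8 * sq h * (A + 3 * v + C * t)
        ≤⟨ *-monoʳ-≤ (8 * sq h) A+3v+Ct≤m+4 ⟩
      8 * sq h * (m + 4)
        ≡⟨ *-distribˡ-+ (8 * sq h) m 4 ⟩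
      8 * sq h * m + 8 * sq h * 4
        ≡⟨ cong (8 * sq h * m +_) (*-comm (8 * sq h) 4 ) ⟩
      8 * sq h * m + 4 * (8 * sq h)
        ≡⟨ cong (8 * sq h * m +_) (*-assoc 4 8 (sq h)) ⟨
      8 * sq h * m + 32 * sq h ∎)
      where
      expand : ∀ r h A v t K → (r + (h + h)) * (r + (h + h)) + 8 * (h * h) * A + 16 * (h * h) * v + K * t * (h * h) + 32 * (h * h)
               ≡ r * r + (4 * r * h + 4 * (h * h) + 8 * (h * h) * A + 16 * (h * h) * v + K * t * (h * h) + 32 * (h * h))
      expand = solve-∀
      regroup : ∀ r h A v t K →
        8 * v * (suc h * suc h) + (4 * r * h + 4 * (h * h) + 8 * (h * h) * A + 16 * (h * h) * v + K * t * (h * h) + 32 * (h * h))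
        ≡ 8 * (h * h) * A + 24 * (h * h) * v + (16 * v * h + 8 * v + 4 * r * h + 36 * (h * h) + K * t * (h * h))
      regroup = solve-∀
      factor : ∀ h A v t C → 8 * (h * h) * A + 24 * (h * h) * v + 8 * C * (t * (h * h)) ≡ 8 * (h * h) * (A + 3 * v + C * t)
      factor = solve-∀

    ¬window-inequality : ¬ WindowInequality m r h
    ¬window-inequality = window-terms⇒contradiction 1≤h r²<2A² r<2A h²≤2v² 2h≤r 2r³≤h⁴Kt terms≤8h²m

  small-radius : ∀ {r m A B Γ} → 1 ≤ r → r ≤ 26 → cb C * r < cb Γ → A + B + Γ ≤ m + 2 → ¬ WindowInequality m r 1
  small-radius {r} {m} {A} {B} {Γ} 1≤r r≤26 C³r<Γ³ A+B+Γ≤m+2 = <⇒≱ (begin-strict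
    (r + (1 + 1)) * (r + (1 + 1)) * (2 * (1 * 1) + m)  ≤⟨ *-monoˡ-≤ (2 + m) (sq-mono-≤ (+-monoˡ-≤ 2 r≤26)) ⟩
    784 * (2 + m)                                     ≡⟨ *-distribˡ-+ 784 2 m ⟩
    1568 + 784 * m                                    <⟨ +-monoˡ-< (784 * m) (<-≤-trans (≤ᵇ⇒≤ 1569 3200 _) (*-monoʳ-≤ 16 200≤m)) ⟩
    16 * m + 784 * m                                  ≡⟨ *-distribʳ-+ m 16 784 ⟨
    (4 * 200) * m                                     ≤⟨ *-monoˡ-≤ m (*-monoʳ-≤ 4 200≤m) ⟩
    (4 * m) * m                                       ≡⟨ *-assoc 4 m m ⟩
    4 * (1 * 1) * (m * m)                             ∎)
    where
    C<Γ : C < Γ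
    C<Γ = cb-cancel-< C Γ (≤-<-trans (m≤m*n (cb C) r {{>-nonZero 1≤r}}) C³r<Γ³)
    200≤m : 200 ≤ m
    200≤m = +-cancelʳ-≤ 2 200 m (≤-trans 202≤1+C (≤-trans C<Γ (≤-trans (m≤n+m Γ (A + B)) A+B+Γ≤m+2)))

  m+3≤A+B+Γ : ∀ {r m A B Γ} → 1 ≤ r → sq r < 2 * sq A → 27 * sq r < 16 * cb B → cb C * r < cb Γ →
              (∀ h → 1 ≤ h → WindowInequality m r h) → m + 3 ≤ A + B + Γ
  m+3≤A+B+Γ {r} {m} {A} {B} {Γ} 1≤r r²<2A² 27r²<16B³ C³r<Γ³ window =
    subst (_≤ A + B + Γ) (sym (+-suc m 2)) (≰⇒> refute)
    where
    refute : ¬ A + B + Γ ≤ m + 2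
    refute A+B+Γ≤m+2 with r ≤? 26
    ... | yes r≤26 = small-radius {r} {m} {A} {B} {Γ} 1≤r r≤26 C³r<Γ³ A+B+Γ≤m+2 (window 1 ≤-refl)
    ... | no  r≰26 = let open LargeRadius {r} {m} {A} {B} {Γ} (≰⇒> r≰26) (scales r 1≤r) r²<2A² 27r²<16B³ C³r<Γ³ A+B+Γ≤m+2
                      in ¬window-inequality (window h 1≤h)


module Floors where

  open import Defs using (SquareDDExists)
  open import Data.Nat
  open import Data.Nat.Properties
  open import Data.Nat.DivMod using (_/_; _%_; m≡m%n+[m/n]*n; m%n<n; m/n*n≤m)
  open import Relation.Binary.PropositionalEquality
  open import Data.Nat.Tactic.RingSolver using (solve-∀)
  open Powers
  open Optimisation using (C; m+3≤A+B+Γ)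
  open WindowCounting using (window-inequality)
  open ≤-Reasoning

  n<[1+n/d]*d : ∀ n d .{{_ : NonZero d}} → n < suc (n / d) * d
  n<[1+n/d]*d n d = begin-strict
    n                      ≡⟨ m≡m%n+[m/n]*n n d ⟩
    n % d + (n / d) * d    <⟨ +-monoˡ-< _ (m%n<n n d) ⟩
    d + (n / d) * d        ≡⟨⟩
    suc (n / d) * d        ∎

  sq-ceiling : ∀ x c n d .{{_ : NonZero d}} .{{_ : NonZero c}} → x * sq d ≤ c * sq n → x < c * sq (suc (n / d))
  sq-ceiling x c n d xd²≤cn² = *-cancelʳ-< _ x (c * sq (suc (n / d))) (begin-strict
    x * sq d                   ≤⟨ xd²≤cn² ⟩
    c * sq n                   <⟨ *-monoʳ-< c (sq-mono-< (n<[1+n/d]*d n d)) ⟩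
    c * sq (suc (n / d) * d)   ≡⟨ identity c (suc (n / d)) d ⟩
    c * sq (suc (n / d)) * sq d ∎)
    where identity : ∀ c a d → c * ((a * d) * (a * d)) ≡ c * (a * a) * (d * d)
          identity = solve-∀

  cb-ceiling : ∀ x c n d .{{_ : NonZero d}} .{{_ : NonZero c}} → x * cb d ≤ c * cb n → x < c * cb (suc (n / d))
  cb-ceiling x c n d xd³≤cn³ = *-cancelʳ-< _ x (c * cb (suc (n / d))) (begin-strict
    x * cb d                   ≤⟨ xd³≤cn³ ⟩
    c * cb n                   <⟨ *-monoʳ-< c (cb-mono-< (n<[1+n/d]*d n d)) ⟩
    c * cb (suc (n / d) * d)   ≡⟨ identity c (suc (n / d)) d ⟩
    c * cb (suc (n / d)) * cb d ∎)
    where identity : ∀ c a d → c * ((a * d) * (a * d) * (a * d)) ≡ c * (a * a * a) * (d * d * d)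
          identity = solve-∀

  -- The theorem for qᵢ = nᵢ / dᵢ with denominators cleared: the integers ⌊qᵢ⌋ + 1 satisfy the strict bounds
  -- required by m+3≤A+B+Γ.
  cleared-bound : ∀ {r m} n₁ d₁ n₂ d₂ n₃ d₃ .{{_ : NonZero d₁}} .{{_ : NonZero d₂}} .{{_ : NonZero d₃}} →
    1 ≤ r → SquareDDExists m r →
    sq r * sq d₁ ≤ 2 * sq n₁ → 27 * sq r * cb d₂ ≤ 16 * cb n₂ → cb C * r * cb d₃ ≤ 1 * cb n₃ →
    m * (d₁ * d₂ * d₃) ≤ n₁ * d₂ * d₃ + n₂ * d₁ * d₃ + n₃ * d₁ * d₂
  cleared-bound {r} {m} n₁ d₁ n₂ d₂ n₃ d₃ 1≤r dd hyp₁ hyp₂ hyp₃ = begin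
    m * (d₁ * d₂ * d₃)
      ≤⟨ *-monoˡ-≤ _ m≤a+b+c ⟩
    (a + b + c) * (d₁ * d₂ * d₃)
      ≡⟨ distribute a b c d₁ d₂ d₃ ⟩
    (a * d₁) * d₂ * d₃ + (b * d₂) * d₁ * d₃ + (c * d₃) * d₁ * d₂
      ≤⟨ +-mono-≤ (+-mono-≤ (*-monoˡ-≤ d₃ (*-monoˡ-≤ d₂ (m/n*n≤m n₁ d₁))) (*-monoˡ-≤ d₃ (*-monoˡ-≤ d₁ (m/n*n≤m n₂ d₂))))
                  (*-monoˡ-≤ d₂ (*-monoˡ-≤ d₁ (m/n*n≤m n₃ d₃))) ⟩
    n₁ * d₂ * d₃ + n₂ * d₁ * d₃ + n₃ * d₁ * d₂ ∎
    where
    a = n₁ / d₁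
    b = n₂ / d₂
    c = n₃ / d₃
    distribute : ∀ a b c x y z → (a + b + c) * (x * y * z) ≡ (a * x) * y * z + (b * y) * x * z + (c * z) * x * y
    distribute = solve-∀
    m≤a+b+c : m ≤ a + b + c
    m≤a+b+c = +-cancelʳ-≤ 3 m (a + b + c) (subst (m + 3 ≤_) (shift a b c)
      (m+3≤A+B+Γ {r} {m} {suc a} {suc b} {suc c} 1≤r (sq-ceiling (sq r) 2 n₁ d₁ hyp₁) (cb-ceiling (27 * sq r) 16 n₂ d₂ hyp₂)
                 (subst (cb C * r <_) (*-identityˡ _) (cb-ceiling (cb C * r) 1 n₃ d₃ hyp₃))
                 (window-inequality dd)))
      where shift : ∀ a b c → suc a + suc b + suc c ≡ a + b + c + 3
            shift = solve-∀


module RationalBounds where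

  open import Defs using (ℕ→ℚ)
  open import Data.Nat as ℕ using (ℕ; suc)
  open import Data.Nat.Properties using (*-identityʳ)
  open import Data.Integer as ℤ using (+_)
  import Data.Integer.Properties as ℤ
  open import Data.Rational using (mkℚ; _≤_; _*_; _+_; toℚᵘ)
  open import Data.Rational.Properties using (toℚᵘ-mono-≤; toℚᵘ-cancel-≤; toℚᵘ-homo-*; toℚᵘ-homo-+; normalize-coprime)
  open import Data.Rational.Unnormalised as ℚᵘ using (ℚᵘ; mkℚᵘ; ↥_; ↧_)
  import Data.Rational.Unnormalised.Properties as ℚᵘ
  import Data.Nat.Coprimality as Coprime
  open import Relation.Binary.PropositionalEquality
  open import Data.Nat.Tactic.RingSolver using (solve-∀)
  open Powers

  toℚᵘ-ℕ→ℚ : ∀ x → toℚᵘ (ℕ→ℚ x) ≡ mkℚᵘ (+ x) 0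
  toℚᵘ-ℕ→ℚ x = cong toℚᵘ (normalize-coprime {x} {0} (Coprime.sym (Coprime.1-coprimeTo x)))

  +a*+b≡+[a*b] : ∀ a b → + a ℤ.* + b ≡ + (a ℕ.* b)
  +a*+b≡+[a*b] a b = sym (ℤ.pos-* a b)

  ≤ᵘ⇒cross-≤ : ∀ {p q : ℚᵘ} {a b} → p ℚᵘ.≤ q → ↥ p ℤ.* ↧ q ≡ + a → ↥ q ℤ.* ↧ p ≡ + b → a ℕ.≤ b
  ≤ᵘ⇒cross-≤ (ℚᵘ.*≤* cross) ≡a ≡b = ℤ.drop‿+≤+ (subst₂ ℤ._≤_ ≡a ≡b cross)

  module _ (n e : ℕ) .{coprime : Coprime.Coprime n (suc e)} where

    private
      q = mkℚ (+ n) e coprime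
      q̂ = mkℚᵘ (+ n) e

    ℕ→ℚ≤c*q²⇒ : ∀ a c → ℕ→ℚ a ≤ ℕ→ℚ c * (q * q) → a ℕ.* sq (suc e) ℕ.≤ c ℕ.* sq n
    ℕ→ℚ≤c*q²⇒ a c a≤cq² = subst₂ ℕ._≤_ (identity a (suc e)) (*-identityʳ (c ℕ.* sq n))
      (≤ᵘ⇒cross-≤ unnormalised (+a*+b≡+[a*b] a (1 ℕ.* sq (suc e)))
        (trans (cong (ℤ._* + 1) (trans (cong (+ c ℤ.*_) (+a*+b≡+[a*b] n n)) (+a*+b≡+[a*b] c (n ℕ.* n))))
               (+a*+b≡+[a*b] (c ℕ.* sq n) 1)))
      where
      identity : ∀ a d → a ℕ.* (1 ℕ.* (d ℕ.* d)) ≡ a ℕ.* (d ℕ.* d)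
      identity = solve-∀
      unnormalised : mkℚᵘ (+ a) 0 ℚᵘ.≤ mkℚᵘ (+ c) 0 ℚᵘ.* (q̂ ℚᵘ.* q̂)
      unnormalised = subst₂ ℚᵘ._≤_ (toℚᵘ-ℕ→ℚ a) (cong (ℚᵘ._* (q̂ ℚᵘ.* q̂)) (toℚᵘ-ℕ→ℚ c))
        (ℚᵘ.≤-respʳ-≃ (ℚᵘ.≃-trans (toℚᵘ-homo-* (ℕ→ℚ c) (q * q)) (ℚᵘ.*-congˡ {toℚᵘ (ℕ→ℚ c)} (toℚᵘ-homo-* q q)))
                      (toℚᵘ-mono-≤ a≤cq²))

    ℕ→ℚ≤c*q³⇒ : ∀ a c → ℕ→ℚ a ≤ ℕ→ℚ c * (q * q * q) → a ℕ.* cb (suc e) ℕ.≤ c ℕ.* cb n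
    ℕ→ℚ≤c*q³⇒ a c a≤cq³ = subst₂ ℕ._≤_ (identity a (suc e)) (*-identityʳ (c ℕ.* cb n))
      (≤ᵘ⇒cross-≤ unnormalised (+a*+b≡+[a*b] a (1 ℕ.* cb (suc e)))
        (trans (cong (ℤ._* + 1) (trans (cong (+ c ℤ.*_) (trans (cong (ℤ._* + n) (+a*+b≡+[a*b] n n)) (+a*+b≡+[a*b] (n ℕ.* n) n)))
                                        (+a*+b≡+[a*b] c (n ℕ.* n ℕ.* n))))
               (+a*+b≡+[a*b] (c ℕ.* cb n) 1)))
      where
      identity : ∀ a d → a ℕ.* (1 ℕ.* (d ℕ.* d ℕ.* d)) ≡ a ℕ.* (d ℕ.* d ℕ.* d)
      identity = solve-∀
      unnormalised : mkℚᵘ (+ a) 0 ℚᵘ.≤ mkℚᵘ (+ c) 0 ℚᵘ.* (q̂ ℚᵘ.* q̂ ℚᵘ.* q̂)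
      unnormalised = subst₂ ℚᵘ._≤_ (toℚᵘ-ℕ→ℚ a) (cong (ℚᵘ._* (q̂ ℚᵘ.* q̂ ℚᵘ.* q̂)) (toℚᵘ-ℕ→ℚ c))
        (ℚᵘ.≤-respʳ-≃ (ℚᵘ.≃-trans (toℚᵘ-homo-* (ℕ→ℚ c) (q * q * q))
                        (ℚᵘ.*-congˡ {toℚᵘ (ℕ→ℚ c)} (ℚᵘ.≃-trans (toℚᵘ-homo-* (q * q) q) (ℚᵘ.*-congʳ {q̂} (toℚᵘ-homo-* q q)))))
                      (toℚᵘ-mono-≤ a≤cq³))

  ℕ→ℚ≤sum⇐ : ∀ m n₁ e₁ n₂ e₂ n₃ e₃ .{c₁ : Coprime.Coprime n₁ (suc e₁)} .{c₂ : Coprime.Coprime n₂ (suc e₂)}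
             .{c₃ : Coprime.Coprime n₃ (suc e₃)} → let d₁ = suc e₁ ; d₂ = suc e₂ ; d₃ = suc e₃ in
    m ℕ.* (d₁ ℕ.* d₂ ℕ.* d₃) ℕ.≤ n₁ ℕ.* d₂ ℕ.* d₃ ℕ.+ n₂ ℕ.* d₁ ℕ.* d₃ ℕ.+ n₃ ℕ.* d₁ ℕ.* d₂ →
    ℕ→ℚ m ≤ mkℚ (+ n₁) e₁ c₁ + mkℚ (+ n₂) e₂ c₂ + mkℚ (+ n₃) e₃ c₃
  ℕ→ℚ≤sum⇐ m n₁ e₁ n₂ e₂ n₃ e₃ {c₁} {c₂} {c₃} cleared =
    toℚᵘ-cancel-≤ (ℚᵘ.≤-respʳ-≃ (ℚᵘ.≃-sym toℚᵘ-sum) (subst (ℚᵘ._≤ q̂₁ ℚᵘ.+ q̂₂ ℚᵘ.+ q̂₃) (sym (toℚᵘ-ℕ→ℚ m)) unnormalised))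
    where
    d₁ = suc e₁
    d₂ = suc e₂
    d₃ = suc e₃
    q̂₁ = mkℚᵘ (+ n₁) e₁
    q̂₂ = mkℚᵘ (+ n₂) e₂
    q̂₃ = mkℚᵘ (+ n₃) e₃
    N : ℕ
    N = (n₁ ℕ.* d₂ ℕ.+ n₂ ℕ.* d₁) ℕ.* d₃ ℕ.+ n₃ ℕ.* (d₁ ℕ.* d₂)
    regroup : ∀ n₁ n₂ n₃ d₁ d₂ d₃ → n₁ ℕ.* d₂ ℕ.* d₃ ℕ.+ n₂ ℕ.* d₁ ℕ.* d₃ ℕ.+ n₃ ℕ.* d₁ ℕ.* d₂
              ≡ ((n₁ ℕ.* d₂ ℕ.+ n₂ ℕ.* d₁) ℕ.* d₃ ℕ.+ n₃ ℕ.* (d₁ ℕ.* d₂)) ℕ.* 1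
    regroup = solve-∀
    ↥sum : (+ n₁ ℤ.* + d₂ ℤ.+ + n₂ ℤ.* + d₁) ℤ.* + d₃ ℤ.+ + n₃ ℤ.* + (d₁ ℕ.* d₂) ≡ + N
    ↥sum = trans (cong₂ ℤ._+_ (trans (cong (ℤ._* + d₃) (trans (cong₂ ℤ._+_ (+a*+b≡+[a*b] n₁ d₂) (+a*+b≡+[a*b] n₂ d₁))
                                                              (sym (ℤ.pos-+ (n₁ ℕ.* d₂) (n₂ ℕ.* d₁)))))
                                     (+a*+b≡+[a*b] (n₁ ℕ.* d₂ ℕ.+ n₂ ℕ.* d₁) d₃))
                              (+a*+b≡+[a*b] n₃ (d₁ ℕ.* d₂)))
                 (sym (ℤ.pos-+ ((n₁ ℕ.* d₂ ℕ.+ n₂ ℕ.* d₁) ℕ.* d₃) (n₃ ℕ.* (d₁ ℕ.* d₂))))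
    unnormalised : mkℚᵘ (+ m) 0 ℚᵘ.≤ q̂₁ ℚᵘ.+ q̂₂ ℚᵘ.+ q̂₃
    unnormalised = ℚᵘ.*≤* (subst₂ ℤ._≤_ (sym (+a*+b≡+[a*b] m (d₁ ℕ.* d₂ ℕ.* d₃)))
                                        (sym (trans (cong (ℤ._* + 1) ↥sum) (+a*+b≡+[a*b] N 1)))
                                        (ℤ.+≤+ (subst (m ℕ.* (d₁ ℕ.* d₂ ℕ.* d₃) ℕ.≤_) (regroup n₁ n₂ n₃ d₁ d₂ d₃) cleared)))
    toℚᵘ-sum : toℚᵘ (mkℚ (+ n₁) e₁ c₁ + mkℚ (+ n₂) e₂ c₂ + mkℚ (+ n₃) e₃ c₃) ℚᵘ.≃ q̂₁ ℚᵘ.+ q̂₂ ℚᵘ.+ q̂₃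
    toℚᵘ-sum = ℚᵘ.≃-trans (toℚᵘ-homo-+ (mkℚ (+ n₁) e₁ c₁ + mkℚ (+ n₂) e₂ c₂) (mkℚ (+ n₃) e₃ c₃))
                          (ℚᵘ.+-congˡ q̂₃ (toℚᵘ-homo-+ (mkℚ (+ n₁) e₁ c₁) (mkℚ (+ n₂) e₂ c₂)))


open import Defs
open import Data.Nat as ℕ using (ℕ; NonZero)
open import Data.Product using (Σ; _,_)
open import Data.Rational using (ℚ; _≤_; _*_; _+_; 0ℚ; mkℚ; *≤*)
open import Data.Rational.Properties using (*-identityˡ)
open import Data.Integer using (+_; -[1+_])
open import Relation.Binary.PropositionalEquality using (subst; sym)
open Optimisation using (C)
open Floors using (cleared-bound)
open RationalBounds using (ℕ→ℚ≤c*q²⇒; ℕ→ℚ≤c*q³⇒; ℕ→ℚ≤sum⇐)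

dd-size-bound : (r m : ℕ) → NonZero r → SquareDDExists m r →
                (q₁ q₂ q₃ : ℚ) → 0ℚ ≤ q₁ → 0ℚ ≤ q₂ → 0ℚ ≤ q₃ →
                ℕ→ℚ (r ℕ.* r) ≤ ℕ→ℚ 2 * (q₁ * q₁) →
                ℕ→ℚ (27 ℕ.* (r ℕ.* r)) ≤ ℕ→ℚ 16 * (q₂ * q₂ * q₂) →
                ℕ→ℚ (C ℕ.* C ℕ.* C ℕ.* r) ≤ q₃ * q₃ * q₃ →
                ℕ→ℚ m ≤ q₁ + q₂ + q₃
dd-size-bound _ _ _ _ (mkℚ -[1+ _ ] _ _) _ _ (*≤* ()) _ _ _ _ _
dd-size-bound _ _ _ _ _ (mkℚ -[1+ _ ] _ _) _ _ (*≤* ()) _ _ _ _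
dd-size-bound _ _ _ _ _ _ (mkℚ -[1+ _ ] _ _) _ _ (*≤* ()) _ _ _
dd-size-bound r@(ℕ.suc _) m _ dd (mkℚ (+ n₁) e₁ c₁) (mkℚ (+ n₂) e₂ c₂) (mkℚ (+ n₃) e₃ c₃) _ _ _ r²≤2q₁² 27r²≤16q₂³ C³r≤q₃³ =
  ℕ→ℚ≤sum⇐ m n₁ e₁ n₂ e₂ n₃ e₃ {c₁} {c₂} {c₃}
    (cleared-bound {r} {m} n₁ (ℕ.suc e₁) n₂ (ℕ.suc e₂) n₃ (ℕ.suc e₃) (ℕ.s≤s ℕ.z≤n) dd
      (ℕ→ℚ≤c*q²⇒ n₁ e₁ {c₁} (r ℕ.* r) 2 r²≤2q₁²)
      (ℕ→ℚ≤c*q³⇒ n₂ e₂ {c₂} (27 ℕ.* (r ℕ.* r)) 16 27r²≤16q₂³)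
      (ℕ→ℚ≤c*q³⇒ n₃ e₃ {c₃} (C ℕ.* C ℕ.* C ℕ.* r) 1 (subst (ℕ→ℚ (C ℕ.* C ℕ.* C ℕ.* r) ≤_) (sym (*-identityˡ _)) C³r≤q₃³)))

theorem6 : Σ ℕ λ C → (r m : ℕ) → NonZero r → SquareDDExists m r →
           (q₁ q₂ q₃ : ℚ) → 0ℚ ≤ q₁ → 0ℚ ≤ q₂ → 0ℚ ≤ q₃ →
           ℕ→ℚ (r ℕ.* r) ≤ ℕ→ℚ 2 * (q₁ * q₁) →
           ℕ→ℚ (27 ℕ.* (r ℕ.* r)) ≤ ℕ→ℚ 16 * (q₂ * q₂ * q₂) →
           ℕ→ℚ (C ℕ.* C ℕ.* C ℕ.* r) ≤ q₃ * q₃ * q₃ →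
           ℕ→ℚ m ≤ q₁ + q₂ + q₃
theorem6 = C , dd-size-bound
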